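{- There is an algorithm that, given a binary word $x$, computes the number $b = \nu x$ of ones in the binary representation of $x$ in $O(\log\log b)$ steps, under the unit cost measure for logical and arithmetical operations including multiplication.
   Context: For a nonnegative integer $x$ written as a binary word, $\nu x$ denotes the number of ones in its binary representation (the "population count" or "sideways addition" of $x$). The model of computation is a machine operating on binary words (integers) in which each of the following operations counts as one step (unit cost measure): bit-wise logical operations (such as bit-wise and), and arithmetical operations including addition, subtraction, multiplication and (integer) division; constant masks and table look-ups of constants are available. -}

module Defs where

open import Data.Nat using (ℕ; zero; suc; _+_; _*_; _∸_; _^_; _≤_; _<_; _≤ᵇ_; _≡ᵇ_)
open import Data.Nat.DivMod using (_/_; _%_)
open import Data.Bool using (Bool; true; false; if_then_else_; _∧_; _∨_; _xor_)
open import Data.List using (List; []; _∷_; length)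
open import Data.List.Relation.Unary.All using (All)
open import Data.Maybe using (Maybe; just; nothing)
open import Data.Product using (_×_)
open import Data.Unit using (⊤)
open import Data.Empty using (⊥)

-- bits with fuel; fuel = n suffices since n / 2 < n for n > 0
bitsF : ℕ → ℕ → List Bool
bitsF zero    _       = []
bitsF (suc f) zero    = []
bitsF (suc f) (suc n) = isOne (suc n % 2) ∷ bitsF f (suc n / 2)
  where
  isOne : ℕ → Bool
  isOne zero    = false
  isOne (suc _) = true

bits : ℕ → List Bool
bits n = bitsF n n

fromBits : List Bool → ℕ
fromBits []       = 0
fromBits (b ∷ bs) = (if b then 1 else 0) + 2 * fromBits bs

ν : ℕ → ℕ
ν x = count (bits x)
  where
  count : List Bool → ℕ
  count []           = 0
  count (true ∷ bs)  = suc (count bs)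
  count (false ∷ bs) = count bs

zipBits : (Bool → Bool → Bool) → List Bool → List Bool → List Bool
zipBits f []       []       = []
zipBits f []       (c ∷ cs) = f false c ∷ zipBits f [] cs
zipBits f (b ∷ bs) []       = f b false ∷ zipBits f bs []
zipBits f (b ∷ bs) (c ∷ cs) = f b c ∷ zipBits f bs cs

bitwise : (Bool → Bool → Bool) → ℕ → ℕ → ℕ
bitwise f a b = fromBits (zipBits f (bits a) (bits b))

-- integer division, with division by zero yielding 0
divℕ : ℕ → ℕ → ℕ
divℕ a zero    = 0
divℕ a (suc d) = a / suc d

-- The machine: a register machine on nonnegative integers (binary words)
-- Registers are indexed by ℕ; every instruction costs one step.

data Op : Set where
  AND OR XOR ADD SUB MUL DIV : Op

evalOp : Op → ℕ → ℕ → ℕ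
evalOp AND a b = bitwise _∧_ a b
evalOp OR  a b = bitwise _∨_ a b
evalOp XOR a b = bitwise _xor_ a b
evalOp ADD a b = a + b
evalOp SUB a b = a ∸ b
evalOp MUL a b = a * b
evalOp DIV a b = divℕ a b

data Instr : Set where
  const  : (d c : ℕ) → Instr
  binop  : (o : Op) (d a b : ℕ) → Instr
  table  : (d : ℕ) (t : List ℕ) (a : ℕ) → Instr  -- R[d] := t[R[a]] (0 if out of range)
  jumpLE : (a b l : ℕ) → Instr
  halt   : Instr

Program : Set
Program = List Instr

lookupℕ : List ℕ → ℕ → ℕ
lookupℕ []       _       = 0
lookupℕ (x ∷ xs) zero    = x
lookupℕ (x ∷ xs) (suc i) = lookupℕ xs i

fetch : Program → ℕ → Maybe Instr
fetch []       _       = nothing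
fetch (i ∷ is) zero    = just i
fetch (i ∷ is) (suc p) = fetch is p

record Config : Set where
  constructor cfg
  field
    pc   : ℕ
    regs : ℕ → ℕ
open Config public

update : (ℕ → ℕ) → ℕ → ℕ → (ℕ → ℕ)
update r d v i = if i ≡ᵇ d then v else r i

exec : Instr → Config → Config
exec (const d c)     (cfg p r) = cfg (suc p) (update r d c)
exec (binop o d a b) (cfg p r) = cfg (suc p) (update r d (evalOp o (r a) (r b)))
exec (table d t a)   (cfg p r) = cfg (suc p) (update r d (lookupℕ t (r a)))
exec (jumpLE a b l)  (cfg p r) = if r a ≤ᵇ r b then cfg l r else cfg (suc p) r
exec halt            c         = c

-- one step; a halted machine (halt instruction or pc outside the program) stays put
step : Program → Config → Config
step P c with fetch P (pc c)
... | just i  = exec i c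
... | nothing = c

run : Program → ℕ → Config → Config
run P zero    c = c
run P (suc t) c = run P t (step P c)

Halted : Program → Config → Set
Halted P c with fetch P (pc c)
... | just halt = ⊤
... | just _    = ⊥
... | nothing   = ⊤

-- input x in register 0, all other registers 0, pc = 0; output in register 0
initial : ℕ → Config
initial x = cfg 0 (λ { zero → x ; (suc _) → 0 })

output : Config → ℕ
output c = regs c 0

-- A program for word length n: all constants (masks, table entries) are
-- n-bit words, and constant tables have at most n entries.
InstrForWidth : ℕ → Instr → Set
InstrForWidth n (const d c)   = c < 2 ^ n
InstrForWidth n (table d t a) = All (_< 2 ^ n) t × length t ≤ n
InstrForWidth n _             = ⊤

ForWidth : ℕ → Program → Set
ForWidth n P = All (InstrForWidth n) P

-- At stage K the word y holds, in fields of width 2^K, the numbers of ones of the consecutive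
-- 2^K-bit blocks of x; y starts as x itself, and one SWAR step (y ∧ M) + ((y / 2^w) ∧ M) adds
-- neighbouring fields, doubling the width. Before each step a single multiplication of y by the
-- repunit 1 + B + ⋯ + B^(m−1), B = 2^(2^K), forms all prefix sums of the fields. If none reaches
-- B, i.e. if ν x < B, the top field of the product is ν x and the program stops. Otherwise some
-- prefix sum wraps around and becomes smaller than the field it added, which a fixed sequence of
-- bit-wise operations detects. Stage K + 1 is thus reached only when ν x ≥ 2^(2^K), so there are
-- at most log₂ log₂ ν x + 1 stages, each of a constant number of steps; the masks and powers
-- needed at stage K are read from constant tables indexed by K.

module Submission where

open import Defs
open import Data.Bool.Base using (Bool; true; false; _∧_; _∨_; T)
open import Data.Empty using (⊥-elim)
open import Data.List.Base using (List; []; _∷_; length; replicate; map; drop; applyUpTo)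
open import Data.List.Properties using (length-applyUpTo)
open import Data.List.Relation.Unary.All using (All; []; _∷_)
import Data.List.Relation.Unary.All as All
open import Data.List.Relation.Unary.All.Properties using (applyUpTo⁺₂)
open import Data.Maybe.Base using (just)
open import Data.Nat.Base
open import Data.Nat.DivMod
open import Data.Nat.Divisibility using (n∣m*n)
open import Data.Nat.ListAction using (sum)
open import Data.Nat.Logarithm using (⌊log₂_⌋; ⌊log₂⌋-mono-≤; ⌊log₂[2^n]⌋≡n)
open import Data.Nat.Properties
open import Data.Nat.Tactic.RingSolver using (solve-∀)
open import Data.Product.Base using (Σ; _×_; _,_)
open import Data.Sum.Base using (_⊎_; inj₁; inj₂)
open import Data.Unit.Base using (tt)
open import Function.Base using (_∘′_)
open import Relation.Binary.PropositionalEquality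
open import Relation.Nullary using (¬_; yes; no)


bit : Bool → ℕ
bit true  = 1
bit false = 0

isSuc : ℕ → Bool
isSuc zero    = false
isSuc (suc _) = true

bit-isSuc : ∀ {r} → r < 2 → bit (isSuc r) ≡ r
bit-isSuc {zero}  _ = refl
bit-isSuc {suc zero} _ = refl
bit-isSuc {suc (suc _)} (s≤s (s≤s ()))

suc[n]/2≤n : ∀ n → suc n / 2 ≤ n
suc[n]/2≤n n = <⇒≤pred (m/n<m (suc n) 2 (s≤s (s≤s z≤n)))

m≡m%2+2*[m/2] : ∀ m → m ≡ m % 2 + 2 * (m / 2)
m≡m%2+2*[m/2] m = trans (m≡m%n+[m/n]*n m 2) (cong (m % 2 +_) (*-comm (m / 2) 2))

m<2^[1+w]⇒m/2<2^w : ∀ w {m} → m < 2 ^ suc w → m / 2 < 2 ^ w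
m<2^[1+w]⇒m/2<2^w w {m} lt = m<n*o⇒m/o<n (subst (m <_) (*-comm 2 (2 ^ w)) lt)

[m+n*d]/d≡n : ∀ {m} n d .{{_ : NonZero d}} → m < d → (m + n * d) / d ≡ n
[m+n*d]/d≡n n d m<d = trans (+-distrib-/-∣ʳ _ (n∣m*n n)) (cong₂ _+_ (m<n⇒m/n≡0 m<d) (m*n/n≡m n d))

[m+n*d]%d≡m : ∀ {m} n d .{{_ : NonZero d}} → m < d → (m + n * d) % d ≡ m
[m+n*d]%d≡m {m} n d m<d = trans ([m+kn]%n≡m%n m n d) (m<n⇒m%n≡m m<d)

m≡m+n*0 : ∀ m n → m ≡ m + n * 0
m≡m+n*0 m n = sym (trans (cong (m +_) (*-zeroʳ n)) (+-identityʳ m))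

bitsF-suc : ∀ f n → bitsF (suc f) (suc n) ≡ isSuc (suc n % 2) ∷ bitsF f (suc n / 2)
bitsF-suc f n with suc n % 2
... | zero  = refl
... | suc _ = refl

bitsF-fuel : ∀ f g n → n ≤ f → n ≤ g → bitsF f n ≡ bitsF g n
bitsF-fuel zero    zero    zero _ _ = refl
bitsF-fuel zero    (suc _) zero _ _ = refl
bitsF-fuel (suc _) zero    zero _ _ = refl
bitsF-fuel (suc _) (suc _) zero _ _ = refl
bitsF-fuel (suc f) (suc g) (suc n) (s≤s n≤f) (s≤s n≤g) = begin
  bitsF (suc f) (suc n)                      ≡⟨ bitsF-suc f n ⟩
  isSuc (suc n % 2) ∷ bitsF f (suc n / 2)    ≡⟨ cong (isSuc (suc n % 2) ∷_) (bitsF-fuel f g (suc n / 2)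
                                                  (≤-trans (suc[n]/2≤n n) n≤f) (≤-trans (suc[n]/2≤n n) n≤g)) ⟩
  isSuc (suc n % 2) ∷ bitsF g (suc n / 2)    ≡⟨ bitsF-suc g n ⟨
  bitsF (suc g) (suc n)                      ∎
  where open ≡-Reasoning

bits-suc : ∀ n → bits (suc n) ≡ isSuc (suc n % 2) ∷ bits (suc n / 2)
bits-suc n = trans (bitsF-suc n n)
  (cong (isSuc (suc n % 2) ∷_) (bitsF-fuel n (suc n / 2) (suc n / 2) (suc[n]/2≤n n) ≤-refl))

ν-suc : ∀ n → ν (suc n) ≡ bit (isSuc (suc n % 2)) + ν (suc n / 2)
ν-suc n with suc n % 2 | bitsF-fuel n (suc n / 2) (suc n / 2) (suc[n]/2≤n n) ≤-refl
... | zero  | eq rewrite eq = refl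
... | suc _ | eq rewrite eq = refl

fromBits-∷ : ∀ b bs → fromBits (b ∷ bs) ≡ bit b + 2 * fromBits bs
fromBits-∷ true  bs = refl
fromBits-∷ false bs = refl

module _ (f : Bool → Bool → Bool) (f-00 : f false false ≡ false) where

  bitwise-/2 : ∀ a b → bitwise f a b ≡
    bit (f (isSuc (a % 2)) (isSuc (b % 2))) + 2 * bitwise f (a / 2) (b / 2)
  bitwise-/2 zero    zero    rewrite f-00 = refl
  bitwise-/2 (suc a) zero    = trans (cong (λ l → fromBits (zipBits f l [])) (bits-suc a))
    (fromBits-∷ (f (isSuc (suc a % 2)) false) (zipBits f (bits (suc a / 2)) []))
  bitwise-/2 zero    (suc b) = trans (cong (λ l → fromBits (zipBits f [] l)) (bits-suc b))
    (fromBits-∷ (f false (isSuc (suc b % 2))) (zipBits f [] (bits (suc b / 2))))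
  bitwise-/2 (suc a) (suc b) = trans (cong₂ (λ l l′ → fromBits (zipBits f l l′)) (bits-suc a) (bits-suc b))
    (fromBits-∷ (f (isSuc (suc a % 2)) (isSuc (suc b % 2))) (zipBits f (bits (suc a / 2)) (bits (suc b / 2))))

  bitwise-bit : ∀ {a c} → a < 2 → c < 2 → bitwise f a c ≡ bit (f (isSuc a) (isSuc c))
  bitwise-bit {zero}     {zero}     _ _ rewrite f-00 = refl
  bitwise-bit {zero}     {suc zero} _ _ = trans (bitwise-/2 0 1) (+-identityʳ _)
  bitwise-bit {suc zero} {zero}     _ _ = trans (bitwise-/2 1 0) (+-identityʳ _)
  bitwise-bit {suc zero} {suc zero} _ _ = trans (bitwise-/2 1 1) (+-identityʳ _)
  bitwise-bit {suc (suc _)} (s≤s (s≤s ())) _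
  bitwise-bit {_} {suc (suc _)} _ (s≤s (s≤s ()))

  bitwise-+2* : ∀ {a c} X Y → a < 2 → c < 2 →
    bitwise f (a + 2 * X) (c + 2 * Y) ≡ bitwise f a c + 2 * bitwise f X Y
  bitwise-+2* {a} {c} X Y a<2 c<2 = begin
    bitwise f (a + 2 * X) (c + 2 * Y)
      ≡⟨ bitwise-/2 (a + 2 * X) (c + 2 * Y) ⟩
    bit (f (isSuc ((a + 2 * X) % 2)) (isSuc ((c + 2 * Y) % 2))) + 2 * bitwise f ((a + 2 * X) / 2) ((c + 2 * Y) / 2)
      ≡⟨ cong₂ (λ u v → bit (f (isSuc u) (isSuc v)) + 2 * bitwise f ((a + 2 * X) / 2) ((c + 2 * Y) / 2))
           (low a<2 X) (low c<2 Y) ⟩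
    bit (f (isSuc a) (isSuc c)) + 2 * bitwise f ((a + 2 * X) / 2) ((c + 2 * Y) / 2)
      ≡⟨ cong₂ (λ u v → bit (f (isSuc a) (isSuc c)) + 2 * bitwise f u v) (high a<2 X) (high c<2 Y) ⟩
    bit (f (isSuc a) (isSuc c)) + 2 * bitwise f X Y
      ≡⟨ cong (_+ 2 * bitwise f X Y) (bitwise-bit a<2 c<2) ⟨
    bitwise f a c + 2 * bitwise f X Y ∎
    where
    open ≡-Reasoning
    low : ∀ {a} → a < 2 → ∀ X → (a + 2 * X) % 2 ≡ a
    low {a} a<2 X = trans (cong (λ z → (a + z) % 2) (*-comm 2 X)) ([m+n*d]%d≡m X 2 a<2)
    high : ∀ {a} → a < 2 → ∀ X → (a + 2 * X) / 2 ≡ X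
    high {a} a<2 X = trans (cong (λ z → (a + z) / 2) (*-comm 2 X)) ([m+n*d]/d≡n X 2 a<2)

  bitwise-split : ∀ w {a c} X Y → a < 2 ^ w → c < 2 ^ w →
    bitwise f (a + 2 ^ w * X) (c + 2 ^ w * Y) ≡ bitwise f a c + 2 ^ w * bitwise f X Y
  bitwise-split zero {zero} {zero} X Y _ _ =
    trans (cong₂ (bitwise f) (*-identityˡ X) (*-identityˡ Y)) (sym (*-identityˡ (bitwise f X Y)))
  bitwise-split zero {suc _} X Y (s≤s ()) _
  bitwise-split zero {zero} {suc _} X Y _ (s≤s ())
  bitwise-split (suc w) {a} {c} X Y a< c< = begin
    bitwise f (a + 2 ^ suc w * X) (c + 2 ^ suc w * Y)
      ≡⟨ cong₂ (bitwise f) (regroup a X) (regroup c Y) ⟩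
    bitwise f (a % 2 + 2 * (a / 2 + 2 ^ w * X)) (c % 2 + 2 * (c / 2 + 2 ^ w * Y))
      ≡⟨ bitwise-+2* (a / 2 + 2 ^ w * X) (c / 2 + 2 ^ w * Y) (m%n<n a 2) (m%n<n c 2) ⟩
    bitwise f (a % 2) (c % 2) + 2 * bitwise f (a / 2 + 2 ^ w * X) (c / 2 + 2 ^ w * Y)
      ≡⟨ cong (λ z → bitwise f (a % 2) (c % 2) + 2 * z)
           (bitwise-split w X Y (m<2^[1+w]⇒m/2<2^w w a<) (m<2^[1+w]⇒m/2<2^w w c<)) ⟩
    bitwise f (a % 2) (c % 2) + 2 * (bitwise f (a / 2) (c / 2) + 2 ^ w * bitwise f X Y)
      ≡⟨ shift (bitwise f (a % 2) (c % 2)) (bitwise f (a / 2) (c / 2)) (2 ^ w) (bitwise f X Y) ⟩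
    (bitwise f (a % 2) (c % 2) + 2 * bitwise f (a / 2) (c / 2)) + 2 ^ suc w * bitwise f X Y
      ≡⟨ cong (_+ 2 ^ suc w * bitwise f X Y) (bitwise-+2* (a / 2) (c / 2) (m%n<n a 2) (m%n<n c 2)) ⟨
    bitwise f (a % 2 + 2 * (a / 2)) (c % 2 + 2 * (c / 2)) + 2 ^ suc w * bitwise f X Y
      ≡⟨ cong (λ u → u + 2 ^ suc w * bitwise f X Y)
           (cong₂ (bitwise f) (m≡m%2+2*[m/2] a) (m≡m%2+2*[m/2] c)) ⟨
    bitwise f a c + 2 ^ suc w * bitwise f X Y ∎
    where
    open ≡-Reasoning
    shift : ∀ x y p z → x + 2 * (y + p * z) ≡ (x + 2 * y) + (2 * p) * z
    shift = solve-∀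
    regroup : ∀ a X → a + 2 ^ suc w * X ≡ a % 2 + 2 * (a / 2 + 2 ^ w * X)
    regroup a X = trans (cong (_+ 2 ^ suc w * X) (m≡m%2+2*[m/2] a)) (sym (shift (a % 2) (a / 2) (2 ^ w) X))

∧-zeroʳ : ∀ a → bitwise _∧_ a 0 ≡ 0
∧-zeroʳ a = go (bits a)
  where
  go : ∀ l → fromBits (zipBits _∧_ l []) ≡ 0
  go []          = refl
  go (true ∷ l)  rewrite go l = refl
  go (false ∷ l) rewrite go l = refl

∧-zeroˡ : ∀ a → bitwise _∧_ 0 a ≡ 0
∧-zeroˡ a = go (bits a)
  where
  go : ∀ l → fromBits (zipBits _∧_ [] l) ≡ 0
  go []      = refl
  go (_ ∷ l) rewrite go l = refl

2^w∸1<2^w : ∀ w → 2 ^ w ∸ 1 < 2 ^ w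
2^w∸1<2^w w with 2 ^ w | m^n>0 2 w
... | suc _ | _ = ≤-refl

2^[1+w]∸1 : ∀ w → 2 ^ suc w ∸ 1 ≡ 1 + 2 * (2 ^ w ∸ 1)
2^[1+w]∸1 w with 2 ^ w | m^n>0 2 w
... | suc p | _ = +-suc p (p + 0)

∧-ones : ∀ w {a} → a < 2 ^ w → bitwise _∧_ a (2 ^ w ∸ 1) ≡ a
∧-ones zero    {zero} _ = refl
∧-ones zero    {suc _} (s≤s ())
∧-ones (suc w) {a} a< = begin
  bitwise _∧_ a (2 ^ suc w ∸ 1)
    ≡⟨ cong₂ (bitwise _∧_) (m≡m%2+2*[m/2] a) (2^[1+w]∸1 w) ⟩
  bitwise _∧_ (a % 2 + 2 * (a / 2)) (1 + 2 * (2 ^ w ∸ 1))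
    ≡⟨ bitwise-+2* _∧_ refl (a / 2) (2 ^ w ∸ 1) (m%n<n a 2) (s≤s (s≤s z≤n)) ⟩
  bitwise _∧_ (a % 2) 1 + 2 * bitwise _∧_ (a / 2) (2 ^ w ∸ 1)
    ≡⟨ cong₂ (λ u v → u + 2 * v) (low (m%n<n a 2)) (∧-ones w (m<2^[1+w]⇒m/2<2^w w a<)) ⟩
  a % 2 + 2 * (a / 2)
    ≡⟨ m≡m%2+2*[m/2] a ⟨
  a ∎
  where
  open ≡-Reasoning
  low : ∀ {x} → x < 2 → bitwise _∧_ x 1 ≡ x
  low {zero}     _ = refl
  low {suc zero} _ = refl
  low {suc (suc _)} (s≤s (s≤s ()))

∧-low : ∀ w {a} X → a < 2 ^ w → bitwise _∧_ (a + 2 ^ w * X) (2 ^ w ∸ 1) ≡ a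
∧-low w {a} X a< = begin
  bitwise _∧_ (a + 2 ^ w * X) (2 ^ w ∸ 1)
    ≡⟨ cong (bitwise _∧_ (a + 2 ^ w * X)) (m≡m+n*0 (2 ^ w ∸ 1) (2 ^ w)) ⟩
  bitwise _∧_ (a + 2 ^ w * X) ((2 ^ w ∸ 1) + 2 ^ w * 0)
    ≡⟨ bitwise-split _∧_ refl w X 0 a< (2^w∸1<2^w w) ⟩
  bitwise _∧_ a (2 ^ w ∸ 1) + 2 ^ w * bitwise _∧_ X 0
    ≡⟨ cong₂ (λ u v → u + 2 ^ w * v) (∧-ones w a<) (∧-zeroʳ X) ⟩
  a + 2 ^ w * 0
    ≡⟨ m≡m+n*0 a (2 ^ w) ⟨
  a ∎
  where open ≡-Reasoning

∧-≤ʳ : ∀ a b → bitwise _∧_ a b ≤ b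
∧-≤ʳ a b = go b a b ≤-refl
  where
  open ≤-Reasoning
  bit-∧ : ∀ x r → bit (x ∧ isSuc r) ≤ r
  bit-∧ false r       = z≤n
  bit-∧ true  zero    = z≤n
  bit-∧ true  (suc r) = s≤s z≤n
  go : ∀ k a b → b ≤ k → bitwise _∧_ a b ≤ b
  go k       a zero    _ = ≤-reflexive (∧-zeroʳ a)
  go (suc k) a (suc b) (s≤s b≤k) = begin
    bitwise _∧_ a (suc b)
      ≡⟨ bitwise-/2 _∧_ refl a (suc b) ⟩
    bit (isSuc (a % 2) ∧ isSuc (suc b % 2)) + 2 * bitwise _∧_ (a / 2) (suc b / 2)
      ≤⟨ +-mono-≤ (bit-∧ (isSuc (a % 2)) (suc b % 2))
           (*-monoʳ-≤ 2 (go k (a / 2) (suc b / 2) (≤-trans (suc[n]/2≤n b) b≤k))) ⟩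
    suc b % 2 + 2 * (suc b / 2)
      ≡⟨ m≡m%2+2*[m/2] (suc b) ⟨
    suc b ∎

∨-<-2^ : ∀ w {a b} → a < 2 ^ w → b < 2 ^ w → bitwise _∨_ a b < 2 ^ w
∨-<-2^ zero    {zero} {zero} _ _ = s≤s z≤n
∨-<-2^ zero    {suc _} (s≤s ()) _
∨-<-2^ zero    {zero} {suc _} _ (s≤s ())
∨-<-2^ (suc w) {a} {b} a< b< = begin-strict
  bitwise _∨_ a b
    ≡⟨ cong₂ (bitwise _∨_) (m≡m%2+2*[m/2] a) (m≡m%2+2*[m/2] b) ⟩
  bitwise _∨_ (a % 2 + 2 * (a / 2)) (b % 2 + 2 * (b / 2))
    ≡⟨ bitwise-+2* _∨_ refl (a / 2) (b / 2) (m%n<n a 2) (m%n<n b 2) ⟩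
  bitwise _∨_ (a % 2) (b % 2) + 2 * bitwise _∨_ (a / 2) (b / 2)
    <⟨ +-monoˡ-< _ (s≤s (≤-trans (≤-reflexive (bitwise-bit _∨_ refl (m%n<n a 2) (m%n<n b 2))) (bit≤1 _))) ⟩
  2 + 2 * bitwise _∨_ (a / 2) (b / 2)
    ≡⟨ *-suc 2 (bitwise _∨_ (a / 2) (b / 2)) ⟨
  2 * suc (bitwise _∨_ (a / 2) (b / 2))
    ≤⟨ *-monoʳ-≤ 2 (∨-<-2^ w (m<2^[1+w]⇒m/2<2^w w a<) (m<2^[1+w]⇒m/2<2^w w b<)) ⟩
  2 ^ suc w ∎
  where
  open ≤-Reasoning
  bit≤1 : ∀ x → bit x ≤ 1
  bit≤1 true  = ≤-refl
  bit≤1 false = z≤n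

infixl 7 _%2^_
_%2^_ : ℕ → ℕ → ℕ
m %2^ n = _%_ m (2 ^ n) {{m^n≢0 2 n}}

∧-%2^ : ∀ n {y} M → y < 2 ^ n → bitwise _∧_ y M ≡ bitwise _∧_ y (M %2^ n)
∧-%2^ n {y} M y< = begin
  bitwise _∧_ y M
    ≡⟨ cong₂ (bitwise _∧_) (m≡m+n*0 y (2 ^ n)) split-M ⟩
  bitwise _∧_ (y + 2 ^ n * 0) (M % 2 ^ n + 2 ^ n * (M / 2 ^ n))
    ≡⟨ bitwise-split _∧_ refl n 0 (M / 2 ^ n) y< (m%n<n M (2 ^ n)) ⟩
  bitwise _∧_ y (M % 2 ^ n) + 2 ^ n * bitwise _∧_ 0 (M / 2 ^ n)
    ≡⟨ cong (λ z → bitwise _∧_ y (M % 2 ^ n) + 2 ^ n * z) (∧-zeroˡ (M / 2 ^ n)) ⟩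
  bitwise _∧_ y (M % 2 ^ n) + 2 ^ n * 0
    ≡⟨ m≡m+n*0 (bitwise _∧_ y (M % 2 ^ n)) (2 ^ n) ⟨
  bitwise _∧_ y (M % 2 ^ n) ∎
  where
  open ≡-Reasoning
  instance _ = m^n≢0 2 n
  split-M : M ≡ M % 2 ^ n + 2 ^ n * (M / 2 ^ n)
  split-M = trans (m≡m%n+[m/n]*n M (2 ^ n)) (cong (M % 2 ^ n +_) (*-comm (M / 2 ^ n) (2 ^ n)))

-- Numerals in radix B

numeral : ℕ → List ℕ → ℕ → ℕ
numeral B []       t = t
numeral B (d ∷ ds) t = d + B * numeral B ds t

numeral-+ : ∀ B ds t u → numeral B ds t + B ^ length ds * u ≡ numeral B ds (t + u)
numeral-+ B []       t u = cong (t +_) (*-identityˡ u)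
numeral-+ B (d ∷ ds) t u = begin
  (d + B * numeral B ds t) + (B * B ^ length ds) * u ≡⟨ regroup d B (numeral B ds t) (B ^ length ds) u ⟩
  d + B * (numeral B ds t + B ^ length ds * u)      ≡⟨ cong (λ z → d + B * z) (numeral-+ B ds t u) ⟩
  d + B * numeral B ds (t + u)                       ∎
  where
  open ≡-Reasoning
  regroup : ∀ d B x p u → (d + B * x) + (B * p) * u ≡ d + B * (x + p * u)
  regroup = solve-∀

numeral-≤-replicate : ∀ B h ds {t u} → All (_≤ h) ds → t ≤ u →
  numeral B ds t ≤ numeral B (replicate (length ds) h) u
numeral-≤-replicate B h []       []         t≤u = t≤u
numeral-≤-replicate B h (d ∷ ds) (d≤h ∷ ds≤h) t≤u =
  +-mono-≤ d≤h (*-monoʳ-≤ B (numeral-≤-replicate B h ds ds≤h t≤u))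

numeral-∧-replicate : ∀ w ds N {c} → length ds ≤ N → All (_< 2 ^ w) ds → c < 2 ^ w →
  bitwise _∧_ (numeral (2 ^ w) ds 0) (numeral (2 ^ w) (replicate N c) 0)
    ≡ numeral (2 ^ w) (map (λ d → bitwise _∧_ d c) ds) 0
numeral-∧-replicate w []       N {c}   _ _ _ = ∧-zeroˡ (numeral (2 ^ w) (replicate N c) 0)
numeral-∧-replicate w (d ∷ ds) (suc N) {c} (s≤s len≤) (d< ∷ ds<) c< =
  trans (bitwise-split _∧_ refl w (numeral (2 ^ w) ds 0) (numeral (2 ^ w) (replicate N c) 0) d< c<)
        (cong (λ z → bitwise _∧_ d c + 2 ^ w * z) (numeral-∧-replicate w ds N len≤ ds< c<))

-- One SWAR step: adding neighbouring fields

pairSums : List ℕ → List ℕ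
pairSums []          = []
pairSums (a ∷ [])    = a ∷ []
pairSums (a ∷ b ∷ r) = a + b ∷ pairSums r

evens : List ℕ → List ℕ
evens []          = []
evens (a ∷ [])    = a ∷ []
evens (a ∷ b ∷ r) = a ∷ evens r

-- the same number, read in radix B²
pack : ℕ → List ℕ → List ℕ
pack B []          = []
pack B (a ∷ [])    = a ∷ []
pack B (a ∷ b ∷ r) = a + B * b ∷ pack B r

length-pairSums : ∀ ds → length (pairSums ds) ≡ ⌈ length ds /2⌉
length-pairSums []          = refl
length-pairSums (a ∷ [])    = refl
length-pairSums (a ∷ b ∷ r) = cong suc (length-pairSums r)

length-pack : ∀ B ds → length (pack B ds) ≡ ⌈ length ds /2⌉
length-pack B []          = refl
length-pack B (a ∷ [])    = refl
length-pack B (a ∷ b ∷ r) = cong suc (length-pack B r)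

sum-pairSums : ∀ ds → sum (pairSums ds) ≡ sum ds
sum-pairSums []          = refl
sum-pairSums (a ∷ [])    = refl
sum-pairSums (a ∷ b ∷ r) = trans (cong (a + b +_) (sum-pairSums r)) (+-assoc a b (sum r))

pairSums-≤ : ∀ {w} ds → All (_≤ w) ds → All (_≤ w + w) (pairSums ds)
pairSums-≤ {w} []          []                 = []
pairSums-≤ {w} (a ∷ [])    (a≤ ∷ [])          = ≤-trans a≤ (m≤m+n w w) ∷ []
pairSums-≤ {w} (a ∷ b ∷ r) (a≤ ∷ b≤ ∷ r≤)     = +-mono-≤ a≤ b≤ ∷ pairSums-≤ r r≤

numeral-pack : ∀ B ds → numeral B ds 0 ≡ numeral (B * B) (pack B ds) 0
numeral-pack B []          = refl
numeral-pack B (a ∷ [])    = cong (a +_) (trans (*-zeroʳ B) (sym (*-zeroʳ (B * B))))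
numeral-pack B (a ∷ b ∷ r) = begin
  a + B * (b + B * numeral B r 0)              ≡⟨ cong (λ z → a + B * (b + B * z)) (numeral-pack B r) ⟩
  a + B * (b + B * numeral (B * B) (pack B r) 0) ≡⟨ regroup a b B _ ⟩
  (a + B * b) + (B * B) * numeral (B * B) (pack B r) 0 ∎
  where
  open ≡-Reasoning
  regroup : ∀ a b B r → a + B * (b + B * r) ≡ (a + B * b) + (B * B) * r
  regroup = solve-∀

numeral-pairSums-≤ : ∀ B .{{_ : NonZero B}} ds → numeral (B * B) (pairSums ds) 0 ≤ numeral B ds 0
numeral-pairSums-≤ B ds = ≤-trans (go ds) (≤-reflexive (sym (numeral-pack B ds)))
  where
  go : ∀ ds → numeral (B * B) (pairSums ds) 0 ≤ numeral (B * B) (pack B ds) 0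
  go []          = z≤n
  go (a ∷ [])    = ≤-refl
  go (a ∷ b ∷ r) = +-mono-≤ (+-monoʳ-≤ a (m≤n*m b B)) (*-monoʳ-≤ (B * B) (go r))

infixl 7 _/2^_
_/2^_ : ℕ → ℕ → ℕ
m /2^ w = _/_ m (2 ^ w) {{m^n≢0 2 w}}

fieldMask : ℕ → ℕ → ℕ
fieldMask w N = numeral (2 ^ (w + w)) (replicate N (2 ^ w ∸ 1)) 0

module _ (w : ℕ) where

  private
    instance _ = m^n≢0 2 w

    2^[w+w] : 2 ^ (w + w) ≡ 2 ^ w * 2 ^ w
    2^[w+w] = ^-distribˡ-+-* 2 w w

  numeral-pack-2^ : ∀ ds → numeral (2 ^ w) ds 0 ≡ numeral (2 ^ (w + w)) (pack (2 ^ w) ds) 0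
  numeral-pack-2^ ds = trans (numeral-pack (2 ^ w) ds) (cong (λ B → numeral B (pack (2 ^ w) ds) 0) (sym 2^[w+w]))

  pack-< : ∀ ds → All (_< 2 ^ w) ds → All (_< 2 ^ (w + w)) (pack (2 ^ w) ds)
  pack-< []          []              = []
  pack-< (a ∷ [])    (a< ∷ [])       = <-≤-trans a< (^-monoʳ-≤ 2 (m≤m+n w w)) ∷ []
  pack-< (a ∷ b ∷ r) (a< ∷ b< ∷ r<)  = subst (a + 2 ^ w * b <_) (sym 2^[w+w]) lt ∷ pack-< r r<
    where
    open ≤-Reasoning
    lt : a + 2 ^ w * b < 2 ^ w * 2 ^ w
    lt = begin-strict
      a + 2 ^ w * b   <⟨ +-monoˡ-< (2 ^ w * b) a< ⟩
      2 ^ w + 2 ^ w * b ≡⟨ *-suc (2 ^ w) b ⟨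
      2 ^ w * suc b   ≤⟨ *-monoʳ-≤ (2 ^ w) b< ⟩
      2 ^ w * 2 ^ w   ∎

  map-∧-pack : ∀ ds → All (_< 2 ^ w) ds → map (λ d → bitwise _∧_ d (2 ^ w ∸ 1)) (pack (2 ^ w) ds) ≡ evens ds
  map-∧-pack []          []             = refl
  map-∧-pack (a ∷ [])    (a< ∷ [])      = cong (_∷ []) (∧-ones w a<)
  map-∧-pack (a ∷ b ∷ r) (a< ∷ _ ∷ r<)  = cong₂ _∷_ (∧-low w b a<) (map-∧-pack r r<)

  ∧-fieldMask : ∀ N ds → length ds ≤ N → All (_< 2 ^ w) ds →
    bitwise _∧_ (numeral (2 ^ w) ds 0) (fieldMask w N) ≡ numeral (2 ^ (w + w)) (evens ds) 0
  ∧-fieldMask N ds len≤ ds< = begin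
    bitwise _∧_ (numeral (2 ^ w) ds 0) (fieldMask w N)
      ≡⟨ cong (λ u → bitwise _∧_ u (fieldMask w N)) (numeral-pack-2^ ds) ⟩
    bitwise _∧_ (numeral (2 ^ (w + w)) (pack (2 ^ w) ds) 0) (fieldMask w N)
      ≡⟨ numeral-∧-replicate (w + w) (pack (2 ^ w) ds) N
           (subst (_≤ N) (sym (length-pack (2 ^ w) ds)) (≤-trans (⌈n/2⌉≤n _) len≤))
           (pack-< ds ds<) (<-≤-trans (2^w∸1<2^w w) (^-monoʳ-≤ 2 (m≤m+n w w))) ⟩
    numeral (2 ^ (w + w)) (map (λ d → bitwise _∧_ d (2 ^ w ∸ 1)) (pack (2 ^ w) ds)) 0
      ≡⟨ cong (λ l → numeral (2 ^ (w + w)) l 0) (map-∧-pack ds ds<) ⟩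
    numeral (2 ^ (w + w)) (evens ds) 0 ∎
    where open ≡-Reasoning

  numeral-/2^ : ∀ ds → All (_< 2 ^ w) ds → numeral (2 ^ w) ds 0 /2^ w ≡ numeral (2 ^ w) (drop 1 ds) 0
  numeral-/2^ []      _         = 0/n≡0 (2 ^ w)
  numeral-/2^ (a ∷ r) (a< ∷ _)  =
    trans (cong (λ z → (a + z) / 2 ^ w) (*-comm (2 ^ w) (numeral (2 ^ w) r 0)))
          ([m+n*d]/d≡n (numeral (2 ^ w) r 0) (2 ^ w) a<)

evens-+ : ∀ C ds → numeral C (evens ds) 0 + numeral C (evens (drop 1 ds)) 0 ≡ numeral C (pairSums ds) 0
evens-+ C []          = refl
evens-+ C (a ∷ [])    = +-identityʳ _
evens-+ C (a ∷ b ∷ r) = begin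
  (a + C * numeral C (evens r) 0) + numeral C (evens (b ∷ r)) 0
    ≡⟨ cong (λ l → (a + C * numeral C (evens r) 0) + numeral C l 0) (evens-∷ r) ⟩
  (a + C * numeral C (evens r) 0) + (b + C * numeral C (evens (drop 1 r)) 0)
    ≡⟨ regroup a b C _ _ ⟩
  (a + b) + C * (numeral C (evens r) 0 + numeral C (evens (drop 1 r)) 0)
    ≡⟨ cong (λ z → (a + b) + C * z) (evens-+ C r) ⟩
  (a + b) + C * numeral C (pairSums r) 0 ∎
  where
  open ≡-Reasoning
  evens-∷ : ∀ r → evens (b ∷ r) ≡ b ∷ evens (drop 1 r)
  evens-∷ []      = refl
  evens-∷ (_ ∷ _) = refl
  regroup : ∀ a b C x y → (a + C * x) + (b + C * y) ≡ (a + b) + C * (x + y)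
  regroup = solve-∀

-- The two masked copies of y hold the even and the odd fields, each in a 2w-bit slot.
swar-step : ∀ w N ds → length ds ≤ N → All (_< 2 ^ w) ds →
  bitwise _∧_ (numeral (2 ^ w) ds 0) (fieldMask w N) + bitwise _∧_ (numeral (2 ^ w) ds 0 /2^ w) (fieldMask w N)
    ≡ numeral (2 ^ (w + w)) (pairSums ds) 0
swar-step w N ds len≤ ds< = begin
  bitwise _∧_ (numeral (2 ^ w) ds 0) (fieldMask w N) + bitwise _∧_ (numeral (2 ^ w) ds 0 /2^ w) (fieldMask w N)
    ≡⟨ cong (λ u → bitwise _∧_ (numeral (2 ^ w) ds 0) (fieldMask w N) + bitwise _∧_ u (fieldMask w N)) (numeral-/2^ w ds ds<) ⟩
  bitwise _∧_ (numeral (2 ^ w) ds 0) (fieldMask w N) + bitwise _∧_ (numeral (2 ^ w) (drop 1 ds) 0) (fieldMask w N)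
    ≡⟨ cong₂ _+_ (∧-fieldMask w N ds len≤ ds<) (∧-fieldMask w N (drop 1 ds) (≤-trans (length-drop1 ds) len≤) (All-drop1 ds<)) ⟩
  numeral (2 ^ (w + w)) (evens ds) 0 + numeral (2 ^ (w + w)) (evens (drop 1 ds)) 0
    ≡⟨ evens-+ (2 ^ (w + w)) ds ⟩
  numeral (2 ^ (w + w)) (pairSums ds) 0 ∎
  where
  open ≡-Reasoning
  length-drop1 : ∀ (ds : List ℕ) → length (drop 1 ds) ≤ length ds
  length-drop1 []      = z≤n
  length-drop1 (_ ∷ _) = n≤1+n _
  All-drop1 : ∀ {P : ℕ → Set} {ds} → All P ds → All P (drop 1 ds)
  All-drop1 []      = []
  All-drop1 (_ ∷ p) = p

-- Detecting overflow of the field sums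

-- With V = y·(1 + B + ⋯ + Bᵐ⁻¹), H = h·(1 + ⋯) and L = (h−1)·(1 + ⋯), every field of
-- geTest V y H L is h or 0 according as the field of V is at least that of y.
geTest : ℕ → ℕ → ℕ → ℕ → ℕ
geTest V y H L = bitwise _∧_ (bitwise _∨_ V (bitwise _∧_ V L + (H ∸ y))) H

geTest-≤ : ∀ V y H L → geTest V y H L ≤ H
geTest-≤ V y H L = ∧-≤ʳ (bitwise _∨_ V (bitwise _∧_ V L + (H ∸ y))) H

prefixSums : ℕ → List ℕ → List ℕ
prefixSums s []       = []
prefixSums s (c ∷ cs) = s + c ∷ prefixSums (s + c) cs

length-prefixSums : ∀ s cs → length (prefixSums s cs) ≡ length cs
length-prefixSums s []       = refl
length-prefixSums s (c ∷ cs) = cong suc (length-prefixSums (s + c) cs)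

∸-digits : ∀ B {h c H y} → c ≤ h → y ≤ H → (h + B * H) ∸ (c + B * y) ≡ (h ∸ c) + B * (H ∸ y)
∸-digits B {h} {c} {H} {y} c≤h y≤H = begin
  (h + B * H) ∸ (c + B * y)
    ≡⟨ cong₂ (λ u z → (u + B * z) ∸ (c + B * y)) (m∸n+n≡m c≤h) (m∸n+n≡m y≤H) ⟨
  ((h ∸ c + c) + B * (H ∸ y + y)) ∸ (c + B * y)
    ≡⟨ cong (_∸ (c + B * y)) (regroup (h ∸ c) c (H ∸ y) y B) ⟩
  ((h ∸ c) + B * (H ∸ y)) + (c + B * y) ∸ (c + B * y)
    ≡⟨ m+n∸n≡m ((h ∸ c) + B * (H ∸ y)) (c + B * y) ⟩
  (h ∸ c) + B * (H ∸ y) ∎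
  where
  open ≡-Reasoning
  regroup : ∀ a c e y B → (a + c) + B * (e + y) ≡ (a + B * e) + (c + B * y)
  regroup = solve-∀

-- Fields are v+1 bits wide; h = 2^v is the top bit of a field.
module Overflow (v : ℕ) where

  h B : ℕ
  h = 2 ^ v
  B = 2 ^ suc v

  instance
    B-nonZero : NonZero B
    B-nonZero = m^n≢0 2 (suc v)

  repunit : ℕ → ℕ
  repunit m = numeral B (replicate m 1) 0

  geDigit : ℕ → ℕ → ℕ
  geDigit d c = bitwise _∧_ (bitwise _∨_ d (bitwise _∧_ d (h ∸ 1) + (h ∸ c))) h

  0<h : 0 < h
  0<h = m^n>0 2 v

  h<B : h < B
  h<B = m<m+n h (≤-trans 0<h (m≤m+n h 0))

  h∸1<h : h ∸ 1 < h
  h∸1<h = 2^w∸1<2^w v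

  low+complement<B : ∀ d c → bitwise _∧_ d (h ∸ 1) + (h ∸ c) < B
  low+complement<B d c = begin-strict
    bitwise _∧_ d (h ∸ 1) + (h ∸ c) ≤⟨ +-mono-≤ (∧-≤ʳ d (h ∸ 1)) (m∸n≤m h c) ⟩
    (h ∸ 1) + h                     <⟨ +-monoˡ-< h h∸1<h ⟩
    h + h                           ≡⟨ cong (h +_) (+-identityʳ h) ⟨
    B                               ∎
    where open ≤-Reasoning

  -- geTest acts field by field, because none of its additions and subtractions carries or borrows.
  geTest-∷ : ∀ d c {V y H L} → d < B → c ≤ h → y ≤ H →
    geTest (d + B * V) (c + B * y) (h + B * H) ((h ∸ 1) + B * L) ≡ geDigit d c + B * geTest V y H L
  geTest-∷ d c {V} {y} {H} {L} d<B c≤h y≤H = begin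
    geTest (d + B * V) (c + B * y) (h + B * H) ((h ∸ 1) + B * L)
      ≡⟨ cong₂ (λ u z → bitwise _∧_ (bitwise _∨_ (d + B * V) (u + z)) (h + B * H))
           (bitwise-split _∧_ refl (suc v) V L d<B (<-trans h∸1<h h<B)) (∸-digits B c≤h y≤H) ⟩
    bitwise _∧_ (bitwise _∨_ (d + B * V) ((dl + B * bitwise _∧_ V L) + ((h ∸ c) + B * (H ∸ y)))) (h + B * H)
      ≡⟨ cong (λ u → bitwise _∧_ (bitwise _∨_ (d + B * V) u) (h + B * H))
           (regroup dl (bitwise _∧_ V L) (h ∸ c) (H ∸ y) B) ⟩
    bitwise _∧_ (bitwise _∨_ (d + B * V) (t + B * t′)) (h + B * H)
      ≡⟨ cong (λ u → bitwise _∧_ u (h + B * H))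
           (bitwise-split _∨_ refl (suc v) V t′ d<B (low+complement<B d c)) ⟩
    bitwise _∧_ (bitwise _∨_ d t + B * bitwise _∨_ V t′) (h + B * H)
      ≡⟨ bitwise-split _∧_ refl (suc v) (bitwise _∨_ V t′) H
           (∨-<-2^ (suc v) d<B (low+complement<B d c)) h<B ⟩
    geDigit d c + B * geTest V y H L ∎
    where
    open ≡-Reasoning
    dl t t′ : ℕ
    dl = bitwise _∧_ d (h ∸ 1)
    t  = dl + (h ∸ c)
    t′ = bitwise _∧_ V L + (H ∸ y)
    regroup : ∀ p q r s B → (p + B * q) + (r + B * s) ≡ (p + r) + B * (q + s)
    regroup = solve-∀

  geDigit-split : ∀ c {dl dh tl th} → dl < h → tl < h → dl + (h ∸ c) ≡ tl + h * th →
    geDigit (dl + h * dh) c ≡ h * bitwise _∧_ (bitwise _∨_ dh th) 1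
  geDigit-split c {dl} {dh} {tl} {th} dl<h tl<h eq = begin
    geDigit (dl + h * dh) c
      ≡⟨ cong (λ u → bitwise _∧_ (bitwise _∨_ (dl + h * dh) (u + (h ∸ c))) h) (∧-low v dh dl<h) ⟩
    bitwise _∧_ (bitwise _∨_ (dl + h * dh) (dl + (h ∸ c))) h
      ≡⟨ cong₂ (λ u z → bitwise _∧_ (bitwise _∨_ (dl + h * dh) u) z) eq (sym (*-identityʳ h)) ⟩
    bitwise _∧_ (bitwise _∨_ (dl + h * dh) (tl + h * th)) (0 + h * 1)
      ≡⟨ cong (λ u → bitwise _∧_ u (0 + h * 1)) (bitwise-split _∨_ refl v dh th dl<h tl<h) ⟩
    bitwise _∧_ (bitwise _∨_ dl tl + h * bitwise _∨_ dh th) (0 + h * 1)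
      ≡⟨ bitwise-split _∧_ refl v (bitwise _∨_ dh th) 1 (∨-<-2^ v dl<h tl<h) 0<h ⟩
    bitwise _∧_ (bitwise _∨_ dl tl) 0 + h * bitwise _∧_ (bitwise _∨_ dh th) 1
      ≡⟨ cong (_+ h * bitwise _∧_ (bitwise _∨_ dh th) 1) (∧-zeroʳ (bitwise _∨_ dl tl)) ⟩
    h * bitwise _∧_ (bitwise _∨_ dh th) 1 ∎
    where open ≡-Reasoning

  geDigit-high : ∀ {d} c → h ≤ d → d < B → geDigit d c ≡ h
  geDigit-high {d} c h≤d d<B = begin
    geDigit d c                              ≡⟨ cong (λ u → geDigit u c) d≡ ⟩
    geDigit ((d ∸ h) + h * 1) c              ≡⟨ geDigit-split c dl<h (m%n<n t h) t≡ ⟩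
    h * bitwise _∧_ (bitwise _∨_ 1 (t / h)) 1 ≡⟨ cong (h *_) (one-∨ (t / h) t/h<2) ⟩
    h * 1                                    ≡⟨ *-identityʳ h ⟩
    h                                        ∎
    where
    open ≡-Reasoning
    instance _ = m^n≢0 2 v
    t = (d ∸ h) + (h ∸ c)
    d≡ : d ≡ (d ∸ h) + h * 1
    d≡ = sym (trans (cong (d ∸ h +_) (*-identityʳ h)) (m∸n+n≡m h≤d))
    dl<h : d ∸ h < h
    dl<h = m<n+o⇒m∸n<o d h (subst (d <_) (cong (h +_) (+-identityʳ h)) d<B)
    t≡ : t ≡ t % h + h * (t / h)
    t≡ = trans (m≡m%n+[m/n]*n t h) (cong (t % h +_) (*-comm (t / h) h))
    t/h<2 : t / h < 2
    t/h<2 = m<n*o⇒m/o<n (subst (t <_) (cong (h +_) (sym (+-identityʳ h))) (+-mono-<-≤ dl<h (m∸n≤m h c)))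
    one-∨ : ∀ x → x < 2 → bitwise _∧_ (bitwise _∨_ 1 x) 1 ≡ 1
    one-∨ zero       _ = refl
    one-∨ (suc zero) _ = refl
    one-∨ (suc (suc _)) (s≤s (s≤s ()))

  geDigit-low : ∀ {d c} → d < h → c ≤ d → geDigit d c ≡ h
  geDigit-low {d} {c} d<h c≤d = begin
    geDigit d c           ≡⟨ cong (λ u → geDigit u c) (m≡m+n*0 d h) ⟩
    geDigit (d + h * 0) c ≡⟨ geDigit-split c d<h (≤-<-trans (m∸n≤m d c) d<h) t≡ ⟩
    h * 1                 ≡⟨ *-identityʳ h ⟩
    h                     ∎
    where
    open ≡-Reasoning
    t≡ : d + (h ∸ c) ≡ (d ∸ c) + h * 1
    t≡ = begin
      d + (h ∸ c)           ≡⟨ cong (_+ (h ∸ c)) (m∸n+n≡m c≤d) ⟨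
      (d ∸ c + c) + (h ∸ c) ≡⟨ +-assoc (d ∸ c) c (h ∸ c) ⟩
      (d ∸ c) + (c + (h ∸ c)) ≡⟨ cong ((d ∸ c) +_) (m+[n∸m]≡n (≤-trans c≤d (<⇒≤ d<h))) ⟩
      (d ∸ c) + h           ≡⟨ cong ((d ∸ c) +_) (*-identityʳ h) ⟨
      (d ∸ c) + h * 1       ∎

  geDigit-< : ∀ {d c} → d < c → c ≤ h → geDigit d c ≡ 0
  geDigit-< {d} {c} d<c c≤h = begin
    geDigit d c           ≡⟨ cong (λ u → geDigit u c) (m≡m+n*0 d h) ⟩
    geDigit (d + h * 0) c ≡⟨ geDigit-split c (<-≤-trans d<c c≤h) t<h (m≡m+n*0 (d + (h ∸ c)) h) ⟩
    h * 0                 ≡⟨ *-zeroʳ h ⟩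
    0                     ∎
    where
    open ≡-Reasoning
    t<h : d + (h ∸ c) < h
    t<h = subst (d + (h ∸ c) <_) (m+[n∸m]≡n c≤h) (+-monoˡ-< (h ∸ c) d<c)

  geDigit-prefix : ∀ s c → s + c < B → geDigit (s + c) c ≡ h
  geDigit-prefix s c lt with s + c <? h
  ... | yes p = geDigit-low p (m≤n+m c s)
  ... | no ¬p = geDigit-high c (≮⇒≥ ¬p) lt

  spread : ℕ → ℕ → ℕ
  spread c m = numeral B (replicate m c) 0

  *-repunit : ∀ c m → c * repunit m ≡ spread c m
  *-repunit c zero    = *-zeroʳ c
  *-repunit c (suc m) = trans (distrib c B (repunit m)) (cong (λ u → c + B * u) (*-repunit c m))
    where
    distrib : ∀ c B r → c * (1 + B * r) ≡ c + B * (c * r)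
    distrib = solve-∀

  repunit-suc : ∀ m → 1 + B * repunit m ≡ repunit m + B ^ m
  repunit-suc zero    = cong suc (*-zeroʳ B)
  repunit-suc (suc m) = begin
    1 + B * (1 + B * repunit m) ≡⟨ cong (λ u → 1 + B * u) (repunit-suc m) ⟩
    1 + B * (repunit m + B ^ m) ≡⟨ regroup (repunit m) (B ^ m) B ⟩
    (1 + B * repunit m) + B * B ^ m ∎
    where
    open ≡-Reasoning
    regroup : ∀ r p B → 1 + B * (r + p) ≡ (1 + B * r) + B * p
    regroup = solve-∀

  -- Multiplying by the repunit forms the prefix sums (above the prefix sums sits junk).
  prefixSums-repunit : ∀ s cs → Σ ℕ λ Z → (s + numeral B cs 0) * repunit (length cs) ≡ numeral B (prefixSums s cs) Z
  prefixSums-repunit s []       = 0 , *-zeroʳ (s + 0)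
  prefixSums-repunit s (c ∷ cs) with prefixSums-repunit (s + c) cs
  ... | Z , eq = Z + y , (begin
    (s + (c + B * y)) * (1 + B * repunit m)
      ≡⟨ expand s c B y (repunit m) ⟩
    (s + c) + B * ((s + c) * repunit m + y * (1 + B * repunit m))
      ≡⟨ cong (λ u → (s + c) + B * ((s + c) * repunit m + y * u)) (repunit-suc m) ⟩
    (s + c) + B * ((s + c) * repunit m + y * (repunit m + B ^ m))
      ≡⟨ cong (λ u → (s + c) + B * u) (collect (s + c) y (repunit m) (B ^ m)) ⟩
    (s + c) + B * ((s + c + y) * repunit m + B ^ m * y)
      ≡⟨ cong (λ u → (s + c) + B * (u + B ^ m * y)) eq ⟩
    (s + c) + B * (numeral B (prefixSums (s + c) cs) Z + B ^ m * y)
      ≡⟨ cong (λ u → (s + c) + B * (numeral B (prefixSums (s + c) cs) Z + B ^ u * y)) (length-prefixSums (s + c) cs) ⟨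
    (s + c) + B * (numeral B (prefixSums (s + c) cs) Z + B ^ length (prefixSums (s + c) cs) * y)
      ≡⟨ cong (λ u → (s + c) + B * u) (numeral-+ B (prefixSums (s + c) cs) Z y) ⟩
    (s + c) + B * numeral B (prefixSums (s + c) cs) (Z + y) ∎)
    where
    open ≡-Reasoning
    m y : ℕ
    m = length cs
    y = numeral B cs 0
    expand : ∀ s c B y r → (s + (c + B * y)) * (1 + B * r) ≡ (s + c) + B * ((s + c) * r + y * (1 + B * r))
    expand = solve-∀
    collect : ∀ a y r p → a * r + y * (r + p) ≡ (a + y) * r + p * y
    collect = solve-∀

  geTest-no-overflow : ∀ s cs Z → All (_≤ h) cs → s + sum cs < B →
    geTest (numeral B (prefixSums s cs) Z) (numeral B cs 0) (spread h (length cs)) (spread (h ∸ 1) (length cs))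
      ≡ spread h (length cs)
  geTest-no-overflow s []       Z []           _  = ∧-zeroʳ (bitwise _∨_ Z (bitwise _∧_ Z 0 + (0 ∸ 0)))
  geTest-no-overflow s (c ∷ cs) Z (c≤h ∷ cs≤h) lt = begin
    geTest ((s + c) + B * numeral B (prefixSums (s + c) cs) Z) (c + B * numeral B cs 0)
           (h + B * spread h (length cs)) ((h ∸ 1) + B * spread (h ∸ 1) (length cs))
      ≡⟨ geTest-∷ (s + c) c s+c<B c≤h (numeral-≤-replicate B h cs cs≤h z≤n) ⟩
    geDigit (s + c) c + B * geTest (numeral B (prefixSums (s + c) cs) Z) (numeral B cs 0)
                                   (spread h (length cs)) (spread (h ∸ 1) (length cs))
      ≡⟨ cong₂ (λ a u → a + B * u) (geDigit-prefix s c s+c<B) (geTest-no-overflow (s + c) cs Z cs≤h lt′) ⟩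
    h + B * spread h (length cs) ∎
    where
    open ≡-Reasoning
    lt′ : s + c + sum cs < B
    lt′ = subst (_< B) (sym (+-assoc s c (sum cs))) lt
    s+c<B : s + c < B
    s+c<B = ≤-<-trans (m≤m+n (s + c) (sum cs)) lt′

  digit-unique : ∀ {a b x y} → a < B → b < B → a + B * x ≡ b + B * y → a ≡ b
  digit-unique {a} {b} {x} {y} a<B b<B eq = begin
    a                 ≡⟨ [m+n*d]%d≡m x B a<B ⟨
    (a + x * B) % B   ≡⟨ cong (_% B) (trans (cong (a +_) (*-comm x B)) (trans eq (cong (b +_) (*-comm B y)))) ⟩
    (b + y * B) % B   ≡⟨ [m+n*d]%d≡m y B b<B ⟩
    b                 ∎
    where open ≡-Reasoning

  -- At the first prefix sum s + c that reaches B, its field holds s + c − B < c.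
  geTest-overflow : ∀ s cs Z → All (_≤ h) cs → s < B → B ≤ s + sum cs →
    geTest (numeral B (prefixSums s cs) Z) (numeral B cs 0) (spread h (length cs)) (spread (h ∸ 1) (length cs))
      ≢ spread h (length cs)
  geTest-overflow s []       Z []           s<B B≤s _ = <⇒≱ s<B (subst (B ≤_) (+-identityʳ s) B≤s)
  geTest-overflow s (c ∷ cs) Z (c≤h ∷ cs≤h) s<B B≤s eq with s + c <? B
  ... | yes s+c<B = geTest-overflow (s + c) cs Z cs≤h s+c<B (subst (B ≤_) (sym (+-assoc s c (sum cs))) B≤s)
    (*-cancelˡ-≡ _ _ B (+-cancelˡ-≡ h _ _ (trans (sym unfold) eq)))
    where
    unfold : geTest (numeral B (prefixSums s (c ∷ cs)) Z) (numeral B (c ∷ cs) 0)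
                    (spread h (suc (length cs))) (spread (h ∸ 1) (suc (length cs)))
           ≡ h + B * geTest (numeral B (prefixSums (s + c) cs) Z) (numeral B cs 0)
                            (spread h (length cs)) (spread (h ∸ 1) (length cs))
    unfold = trans (geTest-∷ (s + c) c s+c<B c≤h (numeral-≤-replicate B h cs cs≤h z≤n))
                 (cong (λ a → a + B * geTest (numeral B (prefixSums (s + c) cs) Z) (numeral B cs 0)
                                               (spread h (length cs)) (spread (h ∸ 1) (length cs)))
                       (geDigit-prefix s c s+c<B))
  ... | no s+c≮B = <⇒≢ 0<h (digit-unique (m^n>0 2 (suc v)) h<B (trans (sym unfold) eq))
    where
    B≤s+c : B ≤ s + c
    B≤s+c = ≮⇒≥ s+c≮B
    d : ℕ
    d = s + c ∸ B
    d<c : d < c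
    d<c = subst (d <_) (m+n∸m≡n B c) (∸-monoˡ-< (+-monoˡ-< c s<B) B≤s+c)
    d≡ : (s + c) + B * numeral B (prefixSums (s + c) cs) Z ≡ d + B * (1 + numeral B (prefixSums (s + c) cs) Z)
    d≡ = trans (cong (_+ B * numeral B (prefixSums (s + c) cs) Z) (sym (m∸n+n≡m B≤s+c)))
               (regroup d B (numeral B (prefixSums (s + c) cs) Z))
      where
      regroup : ∀ d B V → (d + B) + B * V ≡ d + B * (1 + V)
      regroup = solve-∀
    unfold : geTest (numeral B (prefixSums s (c ∷ cs)) Z) (numeral B (c ∷ cs) 0)
                    (spread h (suc (length cs))) (spread (h ∸ 1) (suc (length cs)))
           ≡ 0 + B * geTest (1 + numeral B (prefixSums (s + c) cs) Z) (numeral B cs 0)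
                            (spread h (length cs)) (spread (h ∸ 1) (length cs))
    unfold = trans (cong (λ u → geTest u (c + B * numeral B cs 0) (h + B * spread h (length cs))
                                        ((h ∸ 1) + B * spread (h ∸ 1) (length cs))) d≡)
           (trans (geTest-∷ d c (<-≤-trans d<c (≤-trans c≤h (<⇒≤ h<B))) c≤h (numeral-≤-replicate B h cs cs≤h z≤n))
                  (cong (λ a → a + B * geTest (1 + numeral B (prefixSums (s + c) cs) Z) (numeral B cs 0)
                                                (spread h (length cs)) (spread (h ∸ 1) (length cs)))
                        (geDigit-< d<c c≤h)))

  geTest-repunit-< : ∀ cs → All (_≤ h) cs → sum cs < B →
    geTest (numeral B cs 0 * repunit (length cs)) (numeral B cs 0)
           (h * repunit (length cs)) ((h ∸ 1) * repunit (length cs))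
      ≡ h * repunit (length cs)
  geTest-repunit-< cs cs≤h lt with prefixSums-repunit 0 cs
  ... | Z , eq rewrite eq | *-repunit h (length cs) | *-repunit (h ∸ 1) (length cs) =
    geTest-no-overflow 0 cs Z cs≤h lt

  geTest-repunit-≥ : ∀ cs → All (_≤ h) cs → B ≤ sum cs →
    geTest (numeral B cs 0 * repunit (length cs)) (numeral B cs 0)
           (h * repunit (length cs)) ((h ∸ 1) * repunit (length cs))
      ≢ h * repunit (length cs)
  geTest-repunit-≥ cs cs≤h ge with prefixSums-repunit 0 cs
  ... | Z , eq rewrite eq | *-repunit h (length cs) | *-repunit (h ∸ 1) (length cs) =
    geTest-overflow 0 cs Z cs≤h (m^n>0 2 (suc v)) ge

  _/B^_ : ℕ → ℕ → ℕ
  x /B^ k = _/_ x (B ^ k) {{m^n≢0 B k}}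

  prefixSums-last : ∀ s c cs Z → s + sum (c ∷ cs) < B →
    numeral B (prefixSums s (c ∷ cs)) Z /B^ length cs ≡ (s + sum (c ∷ cs)) + B * Z
  prefixSums-last s c []        Z lt = trans (n/1≡n _) (cong (λ u → s + u + B * Z) (sym (+-identityʳ c)))
  prefixSums-last s c (c′ ∷ cs) Z lt = begin
    ((s + c) + B * Y) / (B * B ^ length cs)
      ≡⟨ m/n/o≡m/[n*o] ((s + c) + B * Y) B (B ^ length cs) ⟨
    ((s + c) + B * Y) / B / B ^ length cs
      ≡⟨ cong (_/ B ^ length cs) (trans (cong (λ z → ((s + c) + z) / B) (*-comm B Y)) ([m+n*d]/d≡n Y B s+c<B)) ⟩
    Y / B ^ length cs
      ≡⟨ prefixSums-last (s + c) c′ cs Z lt′ ⟩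
    (s + c + sum (c′ ∷ cs)) + B * Z
      ≡⟨ cong (_+ B * Z) (+-assoc s c _) ⟩
    (s + sum (c ∷ c′ ∷ cs)) + B * Z ∎
    where
    open ≡-Reasoning
    instance
      _ = m^n≢0 B (length cs)
      _ = m^n≢0 B (suc (length cs))
    Y : ℕ
    Y = numeral B (prefixSums (s + c) (c′ ∷ cs)) Z
    lt′ : s + c + sum (c′ ∷ cs) < B
    lt′ = subst (_< B) (sym (+-assoc s c _)) lt
    s+c<B : s + c < B
    s+c<B = ≤-<-trans (m≤m+n (s + c) _) lt′

  repunit-sum : ∀ cs → 1 ≤ length cs → sum cs < B →
    bitwise _∧_ ((numeral B cs 0 * repunit (length cs)) /B^ (length cs ∸ 1)) (B ∸ 1) ≡ sum cs
  repunit-sum (c ∷ cs) _ lt with prefixSums-repunit 0 (c ∷ cs)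
  ... | Z , eq rewrite eq | prefixSums-last 0 c cs Z lt = ∧-low (suc v) Z lt

  repunit-< : ∀ k → repunit (suc k) < 2 * B ^ k
  repunit-< zero    = ≤-reflexive (cong (λ u → suc (suc u)) (*-zeroʳ B))
  repunit-< (suc k) = begin
    2 + B * repunit (suc k) ≤⟨ +-monoˡ-≤ (B * repunit (suc k)) (*-monoʳ-≤ 2 (m^n>0 2 v)) ⟩
    B + B * repunit (suc k) ≡⟨ *-suc B (repunit (suc k)) ⟨
    B * suc (repunit (suc k)) ≤⟨ *-monoʳ-≤ B (repunit-< k) ⟩
    B * (2 * B ^ k)         ≡⟨ x*[2*y]≡2*[x*y] B (B ^ k) ⟩
    2 * (B * B ^ k)         ∎
    where
    open ≤-Reasoning
    x*[2*y]≡2*[x*y] : ∀ x y → x * (2 * y) ≡ 2 * (x * y)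
    x*[2*y]≡2*[x*y] = solve-∀

n<2^n : ∀ n → n < 2 ^ n
n<2^n zero    = s≤s z≤n
n<2^n (suc n) = begin
  suc (suc n)     ≡⟨ +-comm 1 (suc n) ⟩
  suc n + 1       ≤⟨ +-mono-≤ (n<2^n n) (m^n>0 2 n) ⟩
  2 ^ n + 2 ^ n   ≡⟨ cong (2 ^ n +_) (+-identityʳ (2 ^ n)) ⟨
  2 ^ suc n       ∎
  where open ≤-Reasoning

bitList : ℕ → ℕ → List ℕ
bitList zero    x = []
bitList (suc n) x = x % 2 ∷ bitList n (x / 2)

length-bitList : ∀ n x → length (bitList n x) ≡ n
length-bitList zero    x = refl
length-bitList (suc n) x = cong suc (length-bitList n (x / 2))

bitList-≤1 : ∀ n x → All (_≤ 1) (bitList n x)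
bitList-≤1 zero    x = []
bitList-≤1 (suc n) x = <⇒≤pred (m%n<n x 2) ∷ bitList-≤1 n (x / 2)

sum-bitList-≤ : ∀ n x → sum (bitList n x) ≤ n
sum-bitList-≤ zero    x = z≤n
sum-bitList-≤ (suc n) x = +-mono-≤ (<⇒≤pred (m%n<n x 2)) (sum-bitList-≤ n (x / 2))

numeral-bitList : ∀ n {x} → x < 2 ^ n → numeral 2 (bitList n x) 0 ≡ x
numeral-bitList zero    {zero} _ = refl
numeral-bitList zero    {suc _} (s≤s ())
numeral-bitList (suc n) {x} x< =
  trans (cong (λ u → x % 2 + 2 * u) (numeral-bitList n (m<2^[1+w]⇒m/2<2^w n x<))) (sym (m≡m%2+2*[m/2] x))

ν-bitList : ∀ n {x} → x < 2 ^ n → ν x ≡ sum (bitList n x)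
ν-bitList zero    {zero} _ = refl
ν-bitList zero    {suc _} (s≤s ())
ν-bitList (suc n) {zero} _ = sym (sum-bitList-0 n)
  where
  sum-bitList-0 : ∀ n → sum (bitList n 0) ≡ 0
  sum-bitList-0 zero    = refl
  sum-bitList-0 (suc n) = sum-bitList-0 n
ν-bitList (suc n) {suc a} x< = trans (ν-suc a)
  (cong₂ _+_ (bit-isSuc (m%n<n (suc a) 2)) (ν-bitList n (m<2^[1+w]⇒m/2<2^w n x<)))

-- Fields at stage K are 2^K bits wide, written width K = topBit K + 1.
topBit : ℕ → ℕ
topBit zero    = zero
topBit (suc K) = topBit K + suc (topBit K)

width : ℕ → ℕ
width K = suc (topBit K)

width≡2^ : ∀ K → width K ≡ 2 ^ K
width≡2^ zero    = refl
width≡2^ (suc K) = trans (cong₂ _+_ (width≡2^ K) (width≡2^ K)) (cong (2 ^ K +_) (sym (+-identityʳ (2 ^ K))))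

K<width : ∀ K → K < width K
K<width K = subst (K <_) (sym (width≡2^ K)) (n<2^n K)

width+width≤2^width : ∀ K → width K + width K ≤ 2 ^ width K
width+width≤2^width K = subst (width K + width K ≤_) (cong (2 ^ topBit K +_) (sym (+-identityʳ (2 ^ topBit K))))
  (+-mono-≤ (n<2^n (topBit K)) (n<2^n (topBit K)))

fields : ℕ → ℕ → ℕ → List ℕ
fields n x zero    = bitList n x
fields n x (suc K) = pairSums (fields n x K)

fieldCount : ℕ → ℕ → ℕ
fieldCount n zero    = n
fieldCount n (suc K) = ⌈ fieldCount n K /2⌉

packed : ℕ → ℕ → ℕ → ℕ
packed n x K = numeral (2 ^ width K) (fields n x K) 0

length-fields : ∀ n x K → length (fields n x K) ≡ fieldCount n K
length-fields n x zero    = length-bitList n x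
length-fields n x (suc K) = trans (length-pairSums (fields n x K)) (cong ⌈_/2⌉ (length-fields n x K))

sum-fields : ∀ n x K → sum (fields n x K) ≡ sum (bitList n x)
sum-fields n x zero    = refl
sum-fields n x (suc K) = trans (sum-pairSums (fields n x K)) (sum-fields n x K)

fields-≤width : ∀ n x K → All (_≤ width K) (fields n x K)
fields-≤width n x zero    = bitList-≤1 n x
fields-≤width n x (suc K) = pairSums-≤ (fields n x K) (fields-≤width n x K)

fields-≤2^topBit : ∀ n x K → All (_≤ 2 ^ topBit K) (fields n x K)
fields-≤2^topBit n x K = All.map (λ p → ≤-trans p (n<2^n (topBit K))) (fields-≤width n x K)

fields-<2^width : ∀ n x K → All (_< 2 ^ width K) (fields n x K)
fields-<2^width n x K = All.map (λ p → <-≤-trans (s≤s p) (n<2^n (width K))) (fields-≤width n x K)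

packed-≤ : ∀ n {x} K → x < 2 ^ n → packed n x K ≤ x
packed-≤ n zero    x< = ≤-reflexive (numeral-bitList n x<)
packed-≤ n {x} (suc K) x< = ≤-trans
  (subst (λ B → numeral B (fields n x (suc K)) 0 ≤ packed n x K) (sym (^-distribˡ-+-* 2 (width K) (width K)))
    (numeral-pairSums-≤ (2 ^ width K) {{m^n≢0 2 (width K)}} (fields n x K)))
  (packed-≤ n K x<)

fieldCount-≤ : ∀ n K → fieldCount n K ≤ n
fieldCount-≤ n zero    = ≤-refl
fieldCount-≤ n (suc K) = ≤-trans (⌈n/2⌉≤n _) (fieldCount-≤ n K)

fieldCount-pos : ∀ n K → 1 ≤ n → 1 ≤ fieldCount n K
fieldCount-pos n zero    1≤n = 1≤n
fieldCount-pos n (suc K) 1≤n with fieldCount n K | fieldCount-pos n K 1≤n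
... | suc zero    | _ = s≤s z≤n
... | suc (suc _) | _ = s≤s z≤n

-- all fields but the last fit in the n-bit word
fieldCount-bound : ∀ n K → 1 ≤ n → (fieldCount n K ∸ 1) * width K < n
fieldCount-bound (suc n) zero _ = s≤s (≤-reflexive (*-identityʳ n))
fieldCount-bound n (suc K) 1≤n = ≤-<-trans shrink (fieldCount-bound n K 1≤n)
  where
  open ≤-Reasoning
  ⌈m/2⌉+⌈m/2⌉≤1+m : ∀ m → ⌈ m /2⌉ + ⌈ m /2⌉ ≤ suc m
  ⌈m/2⌉+⌈m/2⌉≤1+m zero          = z≤n
  ⌈m/2⌉+⌈m/2⌉≤1+m (suc zero)    = ≤-refl
  ⌈m/2⌉+⌈m/2⌉≤1+m (suc (suc m)) = s≤s (subst (_≤ suc (suc m)) (sym (+-suc ⌈ m /2⌉ ⌈ m /2⌉)) (s≤s (⌈m/2⌉+⌈m/2⌉≤1+m m)))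
  halve : ∀ m → (⌈ m /2⌉ ∸ 1) + (⌈ m /2⌉ ∸ 1) ≤ m ∸ 1
  halve zero          = z≤n
  halve (suc zero)    = z≤n
  halve (suc (suc m)) = ⌈m/2⌉+⌈m/2⌉≤1+m m
  shrink : (⌈ fieldCount n K /2⌉ ∸ 1) * width (suc K) ≤ (fieldCount n K ∸ 1) * width K
  shrink = begin
    (⌈ fieldCount n K /2⌉ ∸ 1) * (width K + width K)        ≡⟨ double (⌈ fieldCount n K /2⌉ ∸ 1) (width K) ⟩
    ((⌈ fieldCount n K /2⌉ ∸ 1) + (⌈ fieldCount n K /2⌉ ∸ 1)) * width K ≤⟨ *-monoˡ-≤ (width K) (halve (fieldCount n K)) ⟩
    (fieldCount n K ∸ 1) * width K ∎
    where
    double : ∀ a w → a * (w + w) ≡ (a + a) * w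
    double = solve-∀

-- The program

jumpLE-taken : ∀ P {p a b l r} → fetch P p ≡ just (jumpLE a b l) → (r a ≤ᵇ r b) ≡ true →
  step P (cfg p r) ≡ cfg l r
jumpLE-taken P {p} fetch≡ le rewrite fetch≡ | le = refl

jumpLE-not-taken : ∀ P {p a b l r} → fetch P p ≡ just (jumpLE a b l) → (r a ≤ᵇ r b) ≡ false →
  step P (cfg p r) ≡ cfg (suc p) r
jumpLE-not-taken P {p} fetch≡ le rewrite fetch≡ | le = refl

run-+ : ∀ P m t c → run P (m + t) c ≡ run P t (run P m c)
run-+ P zero    t c = refl
run-+ P (suc m) t c = run-+ P m t (step P c)

-- Stating the split with an explicit total keeps the type checker from unfolding run.
run-split : ∀ P t m u c → m + u ≡ t → run P t c ≡ run P u (run P m c)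
run-split P t m u c refl = run-+ P m u c

lookupℕ-applyUpTo : ∀ f {N i} → i < N → lookupℕ (applyUpTo f N) i ≡ f i
lookupℕ-applyUpTo f {suc N} {zero}  _         = refl
lookupℕ-applyUpTo f {suc N} {suc i} (s≤s i<N) = lookupℕ-applyUpTo (f ∘′ suc) i<N

-- The number of steps when the loop runs s + 1 times; opaque, since unfolding run on it is very slow.
opaque
  loopTime : ℕ → ℕ
  loopTime s = s * 21 + 16

  loopTime≡ : ∀ s → loopTime s ≡ s * 21 + 16
  loopTime≡ s = refl

  loopTime-zero : loopTime 0 ≡ 16
  loopTime-zero = refl

  loopTime-suc : ∀ s → loopTime (suc s) ≡ 21 + loopTime s
  loopTime-suc s = +-assoc 21 (s * 21) 16

module Popcount (n : ℕ) where

  -- Entry K of a table is the constant for stage K, reduced to n bits.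
  tableOf : (ℕ → ℕ) → List ℕ
  tableOf f = applyUpTo (λ K → f K %2^ n) n

  base half ones lastPlace : ℕ → ℕ
  base K      = 2 ^ width K
  half K      = 2 ^ topBit K
  ones K      = Overflow.repunit (topBit K) (fieldCount n K)
  lastPlace K = base K ^ (fieldCount n K ∸ 1)

  mask : ℕ → ℕ
  mask K = fieldMask (width K) n

  -- Register 0 holds the packed fields y, register 1 the stage K, the others are scratch.
  -- The program is opaque: unfolding it wholesale makes type checking explode.
  opaque
    prog : Program
    prog =
      table 2 (tableOf ones) 1 ∷                      --  0
      binop MUL 3 0 2 ∷                               --  1  V := y · repunit
      table 4 (tableOf half) 1 ∷                      --  2
      binop MUL 5 4 2 ∷                               --  3  H := h · repunit
      table 6 (tableOf (λ K → half K ∸ 1)) 1 ∷        --  4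
      binop MUL 6 6 2 ∷                               --  5  L := (h − 1) · repunit
      binop AND 6 3 6 ∷                               --  6
      binop SUB 7 5 0 ∷                               --  7
      binop ADD 6 6 7 ∷                               --  8
      binop OR 6 3 6 ∷                                --  9
      binop AND 6 6 5 ∷                               -- 10  geTest V y H L
      jumpLE 5 6 21 ∷                                 -- 11  no overflow (geTest ≤ H always): exit
      table 2 (tableOf mask) 1 ∷                      -- 12
      binop AND 3 0 2 ∷                               -- 13
      table 4 (tableOf base) 1 ∷                      -- 14
      binop DIV 4 0 4 ∷                               -- 15
      binop AND 4 4 2 ∷                               -- 16
      binop ADD 0 3 4 ∷                               -- 17  y := pairwise sums of fields
      const 8 1 ∷                                     -- 18
      binop ADD 1 1 8 ∷                               -- 19  K := K + 1
      jumpLE 8 8 0 ∷                                  -- 20  unconditional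
      table 2 (tableOf lastPlace) 1 ∷                 -- 21
      binop DIV 3 3 2 ∷                               -- 22
      table 2 (tableOf (λ K → base K ∸ 1)) 1 ∷        -- 23
      binop AND 0 3 2 ∷                               -- 24  the top field of V
      halt ∷ []                                       -- 25

  tableOf-forWidth : ∀ f → All (_< 2 ^ n) (tableOf f) × length (tableOf f) ≤ n
  tableOf-forWidth f = applyUpTo⁺₂ _ n (λ K → m%n<n (f K) (2 ^ n) {{m^n≢0 2 n}}) , ≤-reflexive (length-applyUpTo _ n)

  opaque
    unfolding prog

    prog-forWidth : 1 ≤ n → ForWidth n prog
    prog-forWidth 1≤n =
      tableOf-forWidth ones ∷ tt ∷ tableOf-forWidth half ∷ tt ∷ tableOf-forWidth (λ K → half K ∸ 1) ∷
      tt ∷ tt ∷ tt ∷ tt ∷ tt ∷ tt ∷ tt ∷ tableOf-forWidth mask ∷ tt ∷ tableOf-forWidth base ∷ tt ∷ tt ∷ tt ∷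
      ^-monoʳ-< 2 (s≤s (s≤s z≤n)) 1≤n ∷ tt ∷ tt ∷ tableOf-forWidth lastPlace ∷ tt ∷
      tableOf-forWidth (λ K → base K ∸ 1) ∷ tt ∷ tt ∷ []

  lookupTable : (ℕ → ℕ) → ℕ → ℕ
  lookupTable f K = lookupℕ (tableOf f) K

  noOverflow : ℕ → ℕ → Bool
  noOverflow y K = lookupTable half K * lookupTable ones K ≤ᵇ
    geTest (y * lookupTable ones K) y (lookupTable half K * lookupTable ones K)
           (lookupTable (λ K → half K ∸ 1) K * lookupTable ones K)

  topField : ℕ → ℕ → ℕ
  topField y K = bitwise _∧_ (divℕ (y * lookupTable ones K) (lookupTable lastPlace K)) (lookupTable (λ K → base K ∸ 1) K)

  nextPacked : ℕ → ℕ → ℕ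
  nextPacked y K = bitwise _∧_ y (lookupTable mask K) + bitwise _∧_ (divℕ y (lookupTable base K)) (lookupTable mask K)

  opaque
    unfolding prog

    afterTest : (ℕ → ℕ) → ℕ → ℕ
    afterTest r = regs (run prog 11 (cfg 0 r))

    run-afterTest : ∀ r → run prog 11 (cfg 0 r) ≡ cfg 11 (afterTest r)
    run-afterTest r = refl

    afterTest-flag : ∀ r → (afterTest r 5 ≤ᵇ afterTest r 6) ≡ noOverflow (r 0) (r 1)
    afterTest-flag r = refl

    fetch-test : fetch prog 11 ≡ just (jumpLE 5 6 21)
    fetch-test = refl

    afterExit : (ℕ → ℕ) → ℕ → ℕ
    afterExit r = regs (run prog 4 (cfg 21 (afterTest r)))

    run-afterExit : ∀ r → run prog 4 (cfg 21 (afterTest r)) ≡ cfg 25 (afterExit r)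
    run-afterExit r = refl

    afterExit-0 : ∀ r → afterExit r 0 ≡ topField (r 0) (r 1)
    afterExit-0 r = refl

    halted-exit : ∀ r → Halted prog (cfg 25 r)
    halted-exit r = tt

    afterContinue : (ℕ → ℕ) → ℕ → ℕ
    afterContinue r = regs (run prog 9 (cfg 12 (afterTest r)))

    run-afterContinue : ∀ r → run prog 9 (cfg 12 (afterTest r)) ≡ cfg 0 (afterContinue r)
    run-afterContinue r = refl

    afterContinue-0 : ∀ r → afterContinue r 0 ≡ nextPacked (r 0) (r 1)
    afterContinue-0 r = refl

    afterContinue-1 : ∀ r → afterContinue r 1 ≡ r 1 + 1
    afterContinue-1 r = refl

  loop-exit : ∀ r → noOverflow (r 0) (r 1) ≡ true → run prog 16 (cfg 0 r) ≡ cfg 25 (afterExit r)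
  loop-exit r e = begin
    run prog 16 (cfg 0 r)              ≡⟨ run-split prog 16 11 5 (cfg 0 r) refl ⟩
    run prog 5 (run prog 11 (cfg 0 r)) ≡⟨ cong (run prog 5) (run-afterTest r) ⟩
    run prog 5 (cfg 11 (afterTest r))  ≡⟨ cong (run prog 4) (jumpLE-taken prog {11} {5} {6} {21} {afterTest r}
                                            fetch-test (trans (afterTest-flag r) e)) ⟩
    run prog 4 (cfg 21 (afterTest r))  ≡⟨ run-afterExit r ⟩
    cfg 25 (afterExit r)               ∎
    where open ≡-Reasoning

  loop-continue : ∀ r t u c → 21 + u ≡ t → noOverflow (r 0) (r 1) ≡ false →
    run prog u (cfg 0 (afterContinue r)) ≡ c → run prog t (cfg 0 r) ≡ c
  loop-continue r t u c t≡ e halts = begin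
    run prog t (cfg 0 r)                 ≡⟨ run-split prog t 21 u (cfg 0 r) t≡ ⟩
    run prog u (run prog 21 (cfg 0 r))   ≡⟨ cong (run prog u) body ⟩
    run prog u (cfg 0 (afterContinue r)) ≡⟨ halts ⟩
    c                                    ∎
    where
    open ≡-Reasoning
    body : run prog 21 (cfg 0 r) ≡ cfg 0 (afterContinue r)
    body = begin
      run prog 21 (cfg 0 r)               ≡⟨ run-split prog 21 11 10 (cfg 0 r) refl ⟩
      run prog 10 (run prog 11 (cfg 0 r)) ≡⟨ cong (run prog 10) (run-afterTest r) ⟩
      run prog 10 (cfg 11 (afterTest r))  ≡⟨ cong (run prog 9) (jumpLE-not-taken prog {11} {5} {6} {21} {afterTest r}
                                               fetch-test (trans (afterTest-flag r) e)) ⟩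
      run prog 9 (cfg 12 (afterTest r))   ≡⟨ run-afterContinue r ⟩
      cfg 0 (afterContinue r)             ∎

≤⇒≤ᵇ≡true : ∀ {m n} → m ≤ n → (m ≤ᵇ n) ≡ true
≤⇒≤ᵇ≡true {m} {n} m≤n with m ≤ᵇ n | ≤⇒≤ᵇ m≤n
... | true | _ = refl

<⇒≤ᵇ≡false : ∀ {m n} → n < m → (m ≤ᵇ n) ≡ false
<⇒≤ᵇ≡false {m} {n} n<m with m ≤ᵇ n in eq
... | false = refl
... | true  = ⊥-elim (<⇒≱ n<m (≤ᵇ⇒≤ m n (subst T (sym eq) tt)))

divℕ≡/ : ∀ a d .{{_ : NonZero d}} → divℕ a d ≡ a / d
divℕ≡/ a (suc d) = refl

%2^-id : ∀ n {a} → a < 2 ^ n → a %2^ n ≡ a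
%2^-id n a< = m<n⇒m%n≡m {{m^n≢0 2 n}} a<

module Stages (n : ℕ) (1≤n : 1 ≤ n) {x : ℕ} (x< : x < 2 ^ n) where

  open Popcount n

  -- The loop reaches stage K iff K = 0 or the test at stage K − 1 detected an overflow.
  Reached : ℕ → Set
  Reached K = K ≡ 0 ⊎ 2 ^ width (pred K) ≤ ν x

  ν≤n : ν x ≤ n
  ν≤n = subst (_≤ n) (sym (ν-bitList n x<)) (sum-bitList-≤ n x)

  width≤n : ∀ K → Reached K → width K ≤ n
  width≤n zero    _             = 1≤n
  width≤n (suc K) (inj₂ 2^w≤ν)  = ≤-trans (width+width≤2^width K) (≤-trans 2^w≤ν ν≤n)

  lookupTable≡ : ∀ f {K} → K < n → f K < 2 ^ n → lookupTable f K ≡ f K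
  lookupTable≡ f K<n fK< = trans (lookupℕ-applyUpTo (λ K → f K %2^ n) K<n) (%2^-id n fK<)

  module Stage (K : ℕ) (reached : Reached K) where

    v m y : ℕ
    v = topBit K
    m = fieldCount n K
    y = packed n x K
    cs : List ℕ
    cs = fields n x K
    open Overflow v

    K<n : K < n
    K<n = <-≤-trans (K<width K) (width≤n K reached)

    B≤2^n : B ≤ 2 ^ n
    B≤2^n = ^-monoʳ-≤ 2 (width≤n K reached)

    h<2^n : h < 2 ^ n
    h<2^n = <-≤-trans h<B B≤2^n

    y<2^n : y < 2 ^ n
    y<2^n = ≤-<-trans (packed-≤ n K x<) x<

    B^[m∸1]≡ : B ^ (m ∸ 1) ≡ 2 ^ (width K * (m ∸ 1))
    B^[m∸1]≡ = ^-*-assoc 2 (width K) (m ∸ 1)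

    2*B^[m∸1]≤2^n : 2 * B ^ (m ∸ 1) ≤ 2 ^ n
    2*B^[m∸1]≤2^n = subst (_≤ 2 ^ n) (cong (2 *_) (sym B^[m∸1]≡))
      (^-monoʳ-≤ 2 (subst (λ e → suc e ≤ n) (*-comm (m ∸ 1) (width K)) (fieldCount-bound n K 1≤n)))

    repunit-<2^n : repunit m < 2 ^ n
    repunit-<2^n with m | fieldCount-pos n K 1≤n | 2*B^[m∸1]≤2^n
    ... | suc k | _ | le = <-≤-trans (repunit-< k) le

    length-cs : length cs ≡ m
    length-cs = length-fields n x K

    sum-cs : sum cs ≡ ν x
    sum-cs = trans (sum-fields n x K) (sym (ν-bitList n x<))

    lookup-ones : lookupTable ones K ≡ repunit (length cs)
    lookup-ones = trans (lookupTable≡ ones K<n repunit-<2^n) (cong repunit (sym length-cs))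

    lookup-half : lookupTable half K ≡ h
    lookup-half = lookupTable≡ half K<n h<2^n

    lookup-half∸1 : lookupTable (λ K → half K ∸ 1) K ≡ h ∸ 1
    lookup-half∸1 = lookupTable≡ (λ K → half K ∸ 1) K<n (≤-<-trans (m∸n≤m h 1) h<2^n)

    noOverflow≡ : noOverflow y K ≡
      (h * repunit (length cs) ≤ᵇ geTest (y * repunit (length cs)) y (h * repunit (length cs)) ((h ∸ 1) * repunit (length cs)))
    noOverflow≡ = go lookup-half lookup-ones lookup-half∸1
      where
      go : ∀ {a c d} → lookupTable half K ≡ a → lookupTable ones K ≡ c → lookupTable (λ K → half K ∸ 1) K ≡ d →
           noOverflow y K ≡ (a * c ≤ᵇ geTest (y * c) y (a * c) (d * c))
      go refl refl refl = refl

    noOverflow-true : ν x < B → noOverflow y K ≡ true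
    noOverflow-true ν<B = trans noOverflow≡ (≤⇒≤ᵇ≡true (≤-reflexive (sym
      (geTest-repunit-< cs (fields-≤2^topBit n x K) (subst (_< B) (sym sum-cs) ν<B)))))

    R : ℕ
    R = repunit (length cs)

    noOverflow-false : ¬ ν x < B → noOverflow y K ≡ false
    noOverflow-false ν≮B = trans noOverflow≡ (<⇒≤ᵇ≡false (≤∧≢⇒< (geTest-≤ (y * R) y (h * R) ((h ∸ 1) * R))
      (geTest-repunit-≥ cs (fields-≤2^topBit n x K) (subst (B ≤_) (sym sum-cs) (≮⇒≥ ν≮B)))))

    topField≡ : ν x < B → topField y K ≡ ν x
    topField≡ ν<B = begin
      topField y K
        ≡⟨ go lookup-lastPlace lookup-base∸1 lookup-ones ⟩
      bitwise _∧_ (divℕ (y * repunit (length cs)) (B ^ (length cs ∸ 1))) (B ∸ 1)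
        ≡⟨ cong (λ u → bitwise _∧_ u (B ∸ 1)) (divℕ≡/ _ (B ^ (length cs ∸ 1)) {{m^n≢0 B (length cs ∸ 1)}}) ⟩
      bitwise _∧_ ((y * repunit (length cs)) /B^ (length cs ∸ 1)) (B ∸ 1)
        ≡⟨ repunit-sum cs (subst (1 ≤_) (sym length-cs) (fieldCount-pos n K 1≤n)) (subst (_< B) (sym sum-cs) ν<B) ⟩
      sum cs
        ≡⟨ sum-cs ⟩
      ν x ∎
      where
      open ≡-Reasoning
      p : ℕ
      p = B ^ (m ∸ 1)
      lastPlace-< : p < 2 ^ n
      lastPlace-< = <-≤-trans (subst (p <_) (cong (p +_) (sym (+-identityʳ p))) (m<m+n p (m^n>0 B (m ∸ 1))))
                              2*B^[m∸1]≤2^n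
      lookup-lastPlace : lookupTable lastPlace K ≡ B ^ (length cs ∸ 1)
      lookup-lastPlace = trans (lookupTable≡ lastPlace K<n lastPlace-<) (cong (λ l → B ^ (l ∸ 1)) (sym length-cs))
      lookup-base∸1 : lookupTable (λ K → base K ∸ 1) K ≡ B ∸ 1
      lookup-base∸1 = lookupTable≡ (λ K → base K ∸ 1) K<n (<-≤-trans (2^w∸1<2^w (width K)) B≤2^n)
      go : ∀ {P q c} → lookupTable lastPlace K ≡ P → lookupTable (λ K → base K ∸ 1) K ≡ q → lookupTable ones K ≡ c →
           topField y K ≡ bitwise _∧_ (divℕ (y * c) P) q
      go refl refl refl = refl

    divℕ-base : divℕ y (base K %2^ n) ≡ y /2^ width K
    divℕ-base with width K <? n
    ... | yes w<n = trans (cong (divℕ y) (%2^-id n (^-monoʳ-< 2 (s≤s (s≤s z≤n)) w<n)))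
                          (divℕ≡/ y B {{m^n≢0 2 (width K)}})
    ... | no w≮n = begin
      divℕ y (base K %2^ n) ≡⟨ cong (divℕ y) (trans (cong (λ w → (2 ^ w) %2^ n) w≡n) (n%n≡0 (2 ^ n) {{m^n≢0 2 n}})) ⟩
      divℕ y 0              ≡⟨ m<n⇒m/n≡0 {{m^n≢0 2 (width K)}} (subst (λ w → y < 2 ^ w) (sym w≡n) y<2^n) ⟨
      y /2^ width K         ∎
      where
      open ≡-Reasoning
      w≡n : width K ≡ n
      w≡n = ≤-antisym (width≤n K reached) (≮⇒≥ w≮n)

    nextPacked≡ : nextPacked y K ≡ packed n x (suc K)
    nextPacked≡ = begin
      nextPacked y K
        ≡⟨ cong₂ (λ M D → bitwise _∧_ y M + bitwise _∧_ (divℕ y D) M)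
             (lookupℕ-applyUpTo (λ K → mask K %2^ n) K<n) (lookupℕ-applyUpTo (λ K → base K %2^ n) K<n) ⟩
      bitwise _∧_ y (mask K %2^ n) + bitwise _∧_ (divℕ y (base K %2^ n)) (mask K %2^ n)
        ≡⟨ cong (λ u → bitwise _∧_ y (mask K %2^ n) + bitwise _∧_ u (mask K %2^ n)) divℕ-base ⟩
      bitwise _∧_ y (mask K %2^ n) + bitwise _∧_ (y /2^ width K) (mask K %2^ n)
        ≡⟨ cong₂ _+_ (∧-%2^ n (mask K) y<2^n) (∧-%2^ n (mask K) y/B<2^n) ⟨
      bitwise _∧_ y (mask K) + bitwise _∧_ (y /2^ width K) (mask K)
        ≡⟨ swar-step (width K) n cs (subst (_≤ n) (sym length-cs) (fieldCount-≤ n K)) (fields-<2^width n x K) ⟩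
      packed n x (suc K) ∎
      where
      open ≡-Reasoning
      y/B<2^n : y /2^ width K < 2 ^ n
      y/B<2^n = ≤-<-trans (m/n≤m y B {{m^n≢0 2 (width K)}}) y<2^n

  -- Started at stage K with registers r, the loop halts after s more stages with output ν x.
  record Finishes (K : ℕ) (r : ℕ → ℕ) : Set where
    constructor finishes
    field
      s         : ℕ
      reached   : Reached (K + s)
      finalRegs : ℕ → ℕ
      halts     : run prog (loopTime s) (cfg 0 r) ≡ cfg 25 finalRegs
      output≡ν  : finalRegs 0 ≡ ν x

  stage-exit : ∀ K r → r 0 ≡ packed n x K → r 1 ≡ K → Reached K → ν x < 2 ^ width K → Finishes K r
  stage-exit K r r0≡ r1≡ reached ν<B = finishes 0 (subst Reached (sym (+-identityʳ K)) reached) (afterExit r)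
    (trans (cong (λ t → run prog t (cfg 0 r)) loopTime-zero)
           (loop-exit r (subst₂ (λ y K → noOverflow y K ≡ true) (sym r0≡) (sym r1≡) (noOverflow-true ν<B))))
    (trans (afterExit-0 r) (trans (cong₂ topField r0≡ r1≡) (topField≡ ν<B)))
    where open Stage K reached

  stage-continue : ∀ K r → r 0 ≡ packed n x K → r 1 ≡ K → Reached K → ¬ ν x < 2 ^ width K →
    Finishes (suc K) (afterContinue r) → Finishes K r
  stage-continue K r r0≡ r1≡ reached ν≮B (finishes s reached′ r′ halts out) =
    finishes (suc s) (subst Reached (sym (+-suc K s)) reached′) r′ halts′ out
    where
    open Stage K reached
    halts′ : run prog (loopTime (suc s)) (cfg 0 r) ≡ cfg 25 r′
    halts′ = loop-continue r (loopTime (suc s)) (loopTime s) (cfg 25 r′) (sym (loopTime-suc s))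
      (subst₂ (λ y K → noOverflow y K ≡ false) (sym r0≡) (sym r1≡) (noOverflow-false ν≮B)) halts

  -- j bounds the number of stages still to come.
  stages : ∀ j K r → r 0 ≡ packed n x K → r 1 ≡ K → Reached K → ν x < 2 ^ width (j + K) → Finishes K r
  stages j K r r0≡ r1≡ reached ν< with ν x <? 2 ^ width K
  ... | yes ν<B = stage-exit K r r0≡ r1≡ reached ν<B
  stages zero    K r r0≡ r1≡ reached ν< | no ν≮B = ⊥-elim (ν≮B ν<)
  stages (suc j) K r r0≡ r1≡ reached ν< | no ν≮B = stage-continue K r r0≡ r1≡ reached ν≮B
    (stages j (suc K) (afterContinue r) next0 next1 (inj₂ (≮⇒≥ ν≮B)) (subst (λ i → ν x < 2 ^ width i) (sym (+-suc j K)) ν<))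
    where
    open Stage K reached
    next0 : afterContinue r 0 ≡ packed n x (suc K)
    next0 = trans (afterContinue-0 r) (trans (cong₂ nextPacked r0≡ r1≡) nextPacked≡)
    next1 : afterContinue r 1 ≡ suc K
    next1 = trans (afterContinue-1 r) (trans (cong (_+ 1) r1≡) (+-comm K 1))

  ν<2^width : ν x < 2 ^ width (n + 0)
  ν<2^width = subst (λ i → ν x < 2 ^ width i) (sym (+-identityʳ n))
    (≤-<-trans ν≤n (<-≤-trans (n<2^n n) (^-monoʳ-≤ 2 (<⇒≤ (K<width n)))))

-- Running time

-- Reaching stage s + 1 needs b ≥ 2^(2^s), so s ≤ log₂ log₂ b.
stages-≤ : ∀ b s → s ≡ 0 ⊎ 2 ^ width (pred s) ≤ b → s ≤ ⌊log₂ ⌊log₂ b ⌋ ⌋ + 1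
stages-≤ b zero    _ = z≤n
stages-≤ b (suc k) (inj₂ 2^w≤b) = subst (_≤ ⌊log₂ ⌊log₂ b ⌋ ⌋ + 1) (+-comm k 1) (+-monoˡ-≤ 1 k≤)
  where
  2^k≤ : 2 ^ k ≤ ⌊log₂ b ⌋
  2^k≤ = subst (_≤ ⌊log₂ b ⌋) (⌊log₂[2^n]⌋≡n (2 ^ k))
    (⌊log₂⌋-mono-≤ (subst (λ w → 2 ^ w ≤ b) (width≡2^ k) 2^w≤b))
  k≤ : k ≤ ⌊log₂ ⌊log₂ b ⌋ ⌋
  k≤ = subst (_≤ ⌊log₂ ⌊log₂ b ⌋ ⌋) (⌊log₂[2^n]⌋≡n k) (⌊log₂⌋-mono-≤ 2^k≤)

time-≤ : ∀ {s m} → s ≤ m → 1 ≤ m → s * 21 + 16 ≤ 37 * m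
time-≤ {s} {m} s≤m 1≤m = begin
  s * 21 + 16     ≤⟨ +-mono-≤ (*-monoˡ-≤ 21 s≤m) (*-monoʳ-≤ 16 1≤m) ⟩
  m * 21 + 16 * m ≡⟨ collect m ⟩
  37 * m          ∎
  where
  open ≤-Reasoning
  collect : ∀ m → m * 21 + 16 * m ≡ 37 * m
  collect = solve-∀

popcount-correct : ∀ n → 1 ≤ n → ∀ x → x < 2 ^ n → Σ ℕ λ t →
  t ≤ 37 * (⌊log₂ ⌊log₂ ν x ⌋ ⌋ + 1)
  × Halted (Popcount.prog n) (run (Popcount.prog n) t (initial x))
  × output (run (Popcount.prog n) t (initial x)) ≡ ν x
popcount-correct n 1≤n x x<
  with Stages.stages n 1≤n x< n 0 (regs (initial x)) (sym (numeral-bitList n x<)) refl (inj₁ refl)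
                     (Stages.ν<2^width n 1≤n x<)
... | Stages.finishes s reached r′ halts out =
  loopTime s ,
  subst (_≤ 37 * (⌊log₂ ⌊log₂ ν x ⌋ ⌋ + 1)) (sym (loopTime≡ s)) (time-≤ (stages-≤ (ν x) s reached) (m≤n+m 1 _)) ,
  subst (Halted (Popcount.prog n)) (sym halts) (Popcount.halted-exit n r′) ,
  trans (cong output halts) out

theorem1 : Σ ℕ λ C → (n : ℕ) → Σ Program λ P → ForWidth n P ×
             ((x : ℕ) → x < 2 ^ n → Σ ℕ λ t →
                t ≤ C * (⌊log₂ ⌊log₂ ν x ⌋ ⌋ + 1)
                × Halted P (run P t (initial x))
                × output (run P t (initial x)) ≡ ν x)
theorem1 = 37 , λ where
  zero    → halt ∷ [] , tt ∷ [] , λ { zero _ → 0 , z≤n , tt , refl ; (suc _) (s≤s ()) }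
  (suc n) → Popcount.prog (suc n) , Popcount.prog-forWidth (suc n) (s≤s z≤n) , popcount-correct (suc n) (s≤s z≤n)
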